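{- Let $\theta\in\mathbb{F}_{q^3}^*$. Then $\mathrm{Pr}(\Pi_\theta)=\mathcal S_{\theta^2}$ and $\mathrm{Sp}(\Pi_\theta)=\mathcal S_{ -\theta^2}$.
   Context: Let $q$ be a prime power, $\mathbb{F}_{q^3}^*=\mathbb{F}_{q^3}\setminus\{0\}$. Points of $\mathrm{PG}(2,q^3)$ have coordinates $(x,y,z)$, lines $[a,b,c]$, incidence iff $ax+by+cz=0$. Let $T=(0,0,1)$ and $m_T=[0,0,1]$ (the line through $(1,0,0)$ and $(0,1,0)$). For $\theta\in\mathbb{F}_{q^3}^*$ let $\mathcal S_\theta=\{(x\theta,x^q,0):x\in\mathbb{F}_{q^3}^*\}$ and $\Pi_\theta=\{(r\theta^{q+1},r^q,r^{q^2}\theta):r\in\mathbb{F}_{q^3}^*\}$ (a subplane of order $q$; its lines are the lines meeting it in $q+1$ points). For a set $\mathcal B$ of points not containing $T$, $\mathrm{Pr}(\mathcal B)=\{TP\cap m_T: P\in\mathcal B\}$; for a subplane $\mathcal B$, $\mathrm{Sp}(\mathcal B)=\{\ell\cap m_T:\ell\text{ a line of }\mathcal B\}$. -}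

module Defs where

open import Level using (0ℓ)
open import Data.Nat as ℕ using (ℕ; zero; suc)
open import Data.Fin using (Fin)
open import Data.Product using (Σ; ∃; _×_; _,_)
open import Data.List using (List; length)
open import Data.List.Membership.Propositional using (_∈_)
open import Data.List.Relation.Unary.Unique.Propositional using (Unique)
open import Relation.Binary.PropositionalEquality using (_≡_; _≢_)
open import Algebra.Core using (Op₁; Op₂)
open import Algebra.Structures using (IsCommutativeRing)

record FiniteField : Set₁ where
  infixl 6 _+_
  infixl 7 _*_
  infix 8 -_
  field
    Carrier : Set
    _+_ _*_ : Op₂ Carrier
    -_ : Op₁ Carrier
    0# 1# : Carrier
    isCommutativeRing : IsCommutativeRing _≡_ _+_ _*_ -_ 0# 1#
    0≢1 : 0# ≢ 1#
    inverse : ∀ x → x ≢ 0# → ∃ λ y → x * y ≡ 1#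
    elems : List Carrier
    elems-unique : Unique elems
    elems-complete : ∀ x → x ∈ elems

-- Geometry of PG(2, F) where F plays the role of F_{q^3}.
module PG (F : FiniteField) (q : ℕ) where
  open FiniteField F

  infixl 8 _^_
  _^_ : Carrier → ℕ → Carrier
  x ^ zero = 1#
  x ^ suc n = x * (x ^ n)

  _-_ : Carrier → Carrier → Carrier
  x - y = x + (- y)

  -- homogeneous coordinates (of points or of lines)
  Triple : Set
  Triple = Carrier × Carrier × Carrier

  zero3 : Triple
  zero3 = (0# , 0# , 0#)

  NonZero3 : Triple → Set
  NonZero3 P = P ≢ zero3

  scale : Carrier → Triple → Triple
  scale l (x , y , z) = (l * x , l * y , l * z)

  _∼_ : Triple → Triple → Set
  P ∼ Q = ∃ λ l → l ≢ 0# × P ≡ scale l Q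

  Incident : Triple → Triple → Set
  Incident (a , b , c) (x , y , z) = (a * x) + (b * y) + (c * z) ≡ 0#

  cross : Triple → Triple → Triple
  cross (a , b , c) (d , e , f) = ((b * f) - (c * e) , (c * d) - (a * f) , (a * e) - (b * d))

  join : Triple → Triple → Triple
  join = cross

  meet : Triple → Triple → Triple
  meet = cross

  T : Triple
  T = (0# , 0# , 1#)

  mT : Triple
  mT = (0# , 0# , 1#)

  -- a "set of points" is a predicate on coordinate triples (invariant under ∼)
  PointSet : Set₁
  PointSet = Triple → Set

  S : Carrier → PointSet
  S θ P = ∃ λ x → x ≢ 0# × P ∼ (x * θ , x ^ q , 0#)

  Π : Carrier → PointSet
  Π θ P = ∃ λ r → r ≢ 0# × P ∼ (r * (θ ^ (q ℕ.+ 1)) , r ^ q , (r ^ (q ℕ.* q)) * θ)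

  Pr : PointSet → PointSet
  Pr B P = ∃ λ Q → B Q × P ∼ meet (join T Q) mT

  -- ℓ is a line of the subplane B: ℓ meets B in exactly q+1 (projective) points
  IsLineOf : PointSet → Triple → Set
  IsLineOf B ℓ =
    NonZero3 ℓ ×
    Σ (Fin (q ℕ.+ 1) → Triple) λ pts →
      (∀ i → B (pts i) × Incident ℓ (pts i)) ×
      (∀ i j → pts i ∼ pts j → i ≡ j) ×
      (∀ P → B P → Incident ℓ P → ∃ λ i → P ∼ pts i)

  Sp : PointSet → PointSet
  Sp B P = ∃ λ ℓ → IsLineOf B ℓ × P ∼ meet ℓ mT

  SameSet : PointSet → PointSet → Set
  SameSet A B = ∀ P → NonZero3 P → (A P → B P) × (B P → A P)

{-# OPTIONS --safe #-}
module Submission where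

-- Write φ x = x ^ q for the Frobenius map of F = 𝔽_{q³}, so that 𝔽q = {x | φ x = x}, put N = φ θ * θ = θ^(q+1)
-- and write the points of Π θ as π r = (r N, φ r, φ (φ r) θ). Projecting π r from T gives (r N, φ r, 0),
-- which is φ θ · (x θ², φ x, 0) for x = r / θ; hence Pr (Π θ) = S (θ²).
-- The line ℓ u = [u, φ u N, φ (φ u) φ θ] satisfies ℓ u · π r = N Tr (u r) with Tr = 1 + φ + φ², so it meets
-- Π θ in the points π (s / u) with s in the trace-zero plane Z, a 2-dimensional 𝔽q-space: a projective line
-- over 𝔽q with q + 1 points. Conversely the line through π r₀ and π r₁ is θ · ℓ (φ (r₀ ∧ r₁)), where
-- r₀ ∧ r₁ = r₀ φ r₁ - φ r₀ r₁ vanishes only when r₁ / r₀ ∈ 𝔽q. So the lines of Π θ are the ℓ u, and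
-- ℓ u ∩ m_T = (φ u N, -u, 0) is a multiple of (-x θ², φ x, 0) with x = 1 / (θ u); hence Sp (Π θ) = S (-θ²).
-- The counts |𝔽q| = q and |Z| = q² come from bounding roots (x^q - x and Tr have degrees q and q²) and from
-- |F| ≤ |Z| |𝔽q|, as x ↦ φ x - x maps F into Z with the cosets of 𝔽q as fibres.

open import Defs

open import Level using (0ℓ)
open import Algebra.Core using (Op₁; Op₂)
open import Algebra.Bundles using (CommutativeRing)
open import Algebra.Structures using (IsCommutativeRing)
open import Data.Empty using (⊥-elim)
open import Data.Fin as Fin using (Fin; toℕ; fromℕ)
open import Data.Fin.Patterns using (0F)
import Data.Fin.Properties as Finₚ
open import Data.Integer as ℤ using (ℤ; -[1+_])
import Data.Integer.Properties as ℤ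
open import Data.List using (List; []; _∷_; _++_; length; lookup; filter; deduplicate; map; foldr; cartesianProductWith)
open import Data.List.Properties using (length-filter; length-deduplicate; length-++; length-map)
open import Data.List.Membership.Propositional using (_∈_; _∉_; find)
open import Data.List.Membership.Propositional.Properties
  using (∈-lookup; ∈-filter⁺; ∈-filter⁻; ∈-map⁺; ∈-map⁻; ∈-cartesianProductWith⁺; deduplicate-∈⇔)
open import Data.List.Membership.Propositional.Properties.WithK using (unique∧set⇒bag)
open import Data.List.Membership.DecPropositional using () renaming (_∈?_ to ∈?)
open import Data.List.Relation.Binary.BagAndSetEquality using (∼bag⇒↭)
open import Data.List.Relation.Binary.Permutation.Propositional using (_↭_; ↭⇒↭ₛ)
open import Data.List.Relation.Binary.Permutation.Propositional.Properties using (↭-length)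
open import Data.List.Relation.Binary.Subset.Propositional using (_⊆_)
open import Data.List.Relation.Unary.All as All using (all?)
open import Data.List.Relation.Unary.All.Properties using (¬All⇒Any¬)
open import Data.List.Relation.Unary.Any as Any using (here; there; index; any?; satisfied)
open import Data.List.Relation.Unary.Any.Properties using (lookup-index)
open import Data.List.Relation.Unary.Unique.Propositional using (Unique; _∷_)
import Data.List.Relation.Unary.Unique.Propositional.Properties as Unique
open import Data.List.Relation.Unary.Unique.DecPropositional.Properties using (deduplicate-!)
open import Data.Maybe using (Maybe; just; nothing)
open import Data.Nat as ℕ using (ℕ; zero; suc)
import Data.Nat.Properties as ℕₚ
open import Data.Nat.Combinatorics using (_C_; nC1≡n; nCn≡1; k>n⇒nCk≡0; nCk+nC[k+1]≡[n+1]C[k+1])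
open import Data.Nat.Divisibility using (_∣_; divides; ∣⇒≤)
open import Data.Nat.Primality using (Prime; euclidsLemma; ¬prime[0]; ¬prime[1]; prime⇒nonZero; prime⇒nonTrivial)
open import Data.Product using (Σ; ∃; _×_; _,_; proj₁; proj₂)
open import Data.Sign as Sign using (Sign)
open import Data.Sum using (inj₁; inj₂)
open import Data.Vec.Functional using (tail; init; last)
open import Function.Base using (_∘_)
open import Function.Bundles using (mk⇔; Equivalence)
open import Relation.Binary.Definitions using (DecidableEquality)
open import Relation.Binary.PropositionalEquality
open import Relation.Nullary using (Dec; yes; no)
open import Relation.Nullary.Decidable using (map′; ¬?)
open import Relation.Unary using (Decidable)

-- Algebra.Solver.Ring compares normal forms by evaluation, so its coefficients must compute;
-- ℤ, mapped by n ↦ n · 1, serves every commutative ring.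
module RingSolver
  {A : Set} {plus times : Op₂ A} {neg : Op₁ A} {0ᴬ 1ᴬ : A}
  (isCommutativeRing : IsCommutativeRing _≡_ plus times neg 0ᴬ 1ᴬ) where

  commutativeRing : CommutativeRing 0ℓ 0ℓ
  commutativeRing = record { isCommutativeRing = isCommutativeRing }

  open CommutativeRing commutativeRing
    using (_+_; _*_; -_; 0#; 1#; _-_; +-monoid; semiring; ring; +-assoc; +-comm; +-identityˡ; +-identityʳ; -‿inverseˡ)
  open import Algebra.Properties.Monoid.Mult.TCOptimised +-monoid using (1+×; ×-homo-+)
  open import Algebra.Properties.Semiring.Mult.TCOptimised semiring using (×1-homo-*) renaming (_×_ to _·_)
  open import Algebra.Properties.Ring ring
    using (-0#≈0#; -‿involutive; -‿+-comm; -‿distribˡ-*; -‿distribʳ-*)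
  open import Algebra.Solver.Ring.AlmostCommutativeRing
    using (AlmostCommutativeRing; fromCommutativeRing; _-Raw-AlmostCommutative⟶_)
  open ≡-Reasoning

  ⟦_⟧ : ℤ → A
  ⟦ ℤ.+ n ⟧      = n · 1#
  ⟦ -[1+ n ] ⟧ = - (suc n · 1#)

  ⊖-homo : ∀ m n → ⟦ m ℤ.⊖ n ⟧ ≡ m · 1# - n · 1#
  ⊖-homo m 0 = begin
    ⟦ m ℤ.⊖ 0 ⟧     ≡⟨ cong ⟦_⟧ (ℤ.⊖-≥ {m} ℕ.z≤n) ⟩
    m · 1#          ≡⟨ sym (+-identityʳ _) ⟩
    m · 1# + 0#     ≡⟨ cong ((m · 1#) +_) (sym -0#≈0#) ⟩
    m · 1# - 0#     ∎
  ⊖-homo 0 (suc n) = begin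
    ⟦ 0 ℤ.⊖ suc n ⟧           ≡⟨ cong ⟦_⟧ (ℤ.⊖-< {0} {suc n} (ℕ.s≤s ℕ.z≤n)) ⟩
    - (suc n · 1#)            ≡⟨ sym (+-identityˡ _) ⟩
    0# - suc n · 1#           ∎
  ⊖-homo (suc m) (suc n) = begin
    ⟦ suc m ℤ.⊖ suc n ⟧              ≡⟨ cong ⟦_⟧ (ℤ.[1+m]⊖[1+n]≡m⊖n m n) ⟩
    ⟦ m ℤ.⊖ n ⟧                      ≡⟨ ⊖-homo m n ⟩
    a - b                            ≡⟨ cong (_- b) (sym (+-identityˡ a)) ⟩
    (0# + a) - b                     ≡⟨ cong (λ z → (z + a) - b) (sym (-‿inverseˡ 1#)) ⟩
    ((- 1# + 1#) + a) - b            ≡⟨ cong (_- b) (+-assoc (- 1#) 1# a) ⟩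
    (- 1# + (1# + a)) - b            ≡⟨ cong (_- b) (+-comm (- 1#) _) ⟩
    ((1# + a) - 1#) - b              ≡⟨ +-assoc (1# + a) (- 1#) (- b) ⟩
    (1# + a) + (- 1# - b)            ≡⟨ cong ((1# + a) +_) (-‿+-comm 1# b) ⟩
    (1# + a) - (1# + b)              ≡⟨ sym (cong₂ _-_ (1+× m 1#) (1+× n 1#)) ⟩
    suc m · 1# - suc n · 1#          ∎
    where
    a b : A
    a = m · 1#
    b = n · 1#

  +-homo : ∀ i j → ⟦ i ℤ.+ j ⟧ ≡ ⟦ i ⟧ + ⟦ j ⟧
  +-homo (ℤ.+ m)      (ℤ.+ n)      = ×-homo-+ 1# m n
  +-homo (ℤ.+ m)      -[1+ n ]   = ⊖-homo m (suc n)
  +-homo -[1+ m ]   (ℤ.+ n)      = trans (⊖-homo n (suc m)) (+-comm _ _)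
  +-homo -[1+ m ]   -[1+ n ]   = begin
    - (suc (suc m ℕ.+ n) · 1#)           ≡⟨ cong (λ k → - (k · 1#)) (sym (ℕₚ.+-suc (suc m) n)) ⟩
    - ((suc m ℕ.+ suc n) · 1#)           ≡⟨ cong -_ (×-homo-+ 1# (suc m) (suc n)) ⟩
    - (suc m · 1# + suc n · 1#)          ≡⟨ sym (-‿+-comm _ _) ⟩
    - (suc m · 1#) + - (suc n · 1#)      ∎

  signed : Sign → A → A
  signed Sign.+ x = x
  signed Sign.- x = - x

  ◃-homo : ∀ s n → ⟦ s ℤ.◃ n ⟧ ≡ signed s (n · 1#)
  ◃-homo Sign.+ 0       = refl
  ◃-homo Sign.- 0       = sym -0#≈0#
  ◃-homo Sign.+ (suc n) = refl
  ◃-homo Sign.- (suc n) = refl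

  signed-* : ∀ s t x y → signed (s Sign.* t) (x * y) ≡ signed s x * signed t y
  signed-* Sign.+ Sign.+ x y = refl
  signed-* Sign.+ Sign.- x y = -‿distribʳ-* x y
  signed-* Sign.- Sign.+ x y = -‿distribˡ-* x y
  signed-* Sign.- Sign.- x y = begin
    x * y            ≡⟨ sym (-‿involutive _) ⟩
    - - (x * y)      ≡⟨ cong -_ (-‿distribʳ-* x y) ⟩
    - (x * - y)      ≡⟨ -‿distribˡ-* x (- y) ⟩
    - x * - y        ∎

  *-homo : ∀ i j → ⟦ i ℤ.* j ⟧ ≡ ⟦ i ⟧ * ⟦ j ⟧
  *-homo i j = begin
    ⟦ s ℤ.◃ ∣i∣ ℕ.* ∣j∣ ⟧                           ≡⟨ ◃-homo s (∣i∣ ℕ.* ∣j∣) ⟩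
    signed s ((∣i∣ ℕ.* ∣j∣) · 1#)                   ≡⟨ cong (signed s) (×1-homo-* ∣i∣ ∣j∣) ⟩
    signed s (∣i∣ · 1# * ∣j∣ · 1#)                  ≡⟨ signed-* (ℤ.sign i) (ℤ.sign j) _ _ ⟩
    signed (ℤ.sign i) (∣i∣ · 1#) * signed (ℤ.sign j) (∣j∣ · 1#) ≡⟨ cong₂ _*_ (signed-abs i) (signed-abs j) ⟩
    ⟦ i ⟧ * ⟦ j ⟧                                   ∎
    where
    s : Sign
    s = ℤ.sign i Sign.* ℤ.sign j
    ∣i∣ ∣j∣ : ℕ
    ∣i∣ = ℤ.∣ i ∣
    ∣j∣ = ℤ.∣ j ∣
    signed-abs : ∀ k → signed (ℤ.sign k) (ℤ.∣ k ∣ · 1#) ≡ ⟦ k ⟧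
    signed-abs (ℤ.+ n)    = refl
    signed-abs -[1+ n ] = refl

  -‿homo : ∀ i → ⟦ ℤ.- i ⟧ ≡ - ⟦ i ⟧
  -‿homo (ℤ.+ 0)  = sym -0#≈0#
  -‿homo (ℤ.+ suc n) = refl
  -‿homo -[1+ n ]  = sym (-‿involutive _)

  homomorphism : CommutativeRing.rawRing ℤ.+-*-commutativeRing
                   -Raw-AlmostCommutative⟶ fromCommutativeRing commutativeRing
  homomorphism = record
    { ⟦_⟧ = ⟦_⟧ ; +-homo = +-homo ; *-homo = *-homo ; -‿homo = -‿homo
    ; 0-homo = refl ; 1-homo = refl }

  image-≟ : ∀ i j → Maybe (⟦ i ⟧ ≡ ⟦ j ⟧)
  image-≟ i j with i ℤ.≟ j
  ... | yes i≡j = just (cong ⟦_⟧ i≡j)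
  ... | no _    = nothing

  open import Algebra.Solver.Ring _ _ homomorphism image-≟ public
    using (solve; _:+_; _:*_; _:-_; :-_; _:=_)
  open import Algebra.Solver.Ring _ _ homomorphism image-≟
    using (con) renaming (Polynomial to Expression)

  0ᶜ 1ᶜ : ∀ {n} → Expression n
  0ᶜ = con (ℤ.+ 0)
  1ᶜ = con (ℤ.+ 1)

cast-injective : ∀ {m n} .(eq : m ≡ n) {i j : Fin m} → Fin.cast eq i ≡ Fin.cast eq j → i ≡ j
cast-injective eq {i} {j} e = Finₚ.toℕ-injective (trans (sym (Finₚ.toℕ-cast eq i)) (trans (cong toℕ e) (Finₚ.toℕ-cast eq j)))

module _ {A : Set} where

  lookup-injective : ∀ {xs : List A} → Unique xs → ∀ i j → lookup xs i ≡ lookup xs j → i ≡ j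
  lookup-injective (_ ∷ _)     Fin.zero    Fin.zero    _ = refl
  lookup-injective (x∉ ∷ _)    Fin.zero    (Fin.suc j) e = ⊥-elim (All.lookup x∉ (∈-lookup j) e)
  lookup-injective (x∉ ∷ _)    (Fin.suc i) Fin.zero    e = ⊥-elim (All.lookup x∉ (∈-lookup i) (sym e))
  lookup-injective (_ ∷ xs!)   (Fin.suc i) (Fin.suc j) e = cong Fin.suc (lookup-injective xs! i j e)

  length-cartesianProductWith : ∀ (f : A → A → A) xs ys →
                                length (cartesianProductWith f xs ys) ≡ length xs ℕ.* length ys
  length-cartesianProductWith f []       ys = refl
  length-cartesianProductWith f (x ∷ xs) ys = begin
    length (map (f x) ys ++ cartesianProductWith f xs ys)    ≡⟨ length-++ (map (f x) ys) ⟩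
    length (map (f x) ys) ℕ.+ length (cartesianProductWith f xs ys)
      ≡⟨ cong₂ ℕ._+_ (length-map (f x) ys) (length-cartesianProductWith f xs ys) ⟩
    length ys ℕ.+ length xs ℕ.* length ys                    ∎
    where open ≡-Reasoning

  unique-⊆-⊇⇒↭ : ∀ {xs ys : List A} → Unique xs → Unique ys → xs ⊆ ys → ys ⊆ xs → xs ↭ ys
  unique-⊆-⊇⇒↭ xs! ys! xs⊆ys ys⊆xs = ∼bag⇒↭ (unique∧set⇒bag xs! ys! (mk⇔ xs⊆ys ys⊆xs))

  module _ (_≟_ : DecidableEquality A) where

    unique-⊆⇒length≤ : ∀ {xs ys : List A} → Unique xs → xs ⊆ ys → length xs ℕ.≤ length ys
    unique-⊆⇒length≤ {xs} {ys} xs! xs⊆ys = begin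
      length xs          ≡⟨ ↭-length (unique-⊆-⊇⇒↭ xs! (deduplicate-! _≟_ zs) ⊆zs zs⊆) ⟩
      length (dedup zs)  ≤⟨ length-deduplicate _≟_ zs ⟩
      length zs          ≤⟨ length-filter ∈xs? ys ⟩
      length ys          ∎
      where
      open ℕₚ.≤-Reasoning
      ∈xs? : Decidable (_∈ xs)
      ∈xs? y = ∈? _≟_ y xs
      zs : List A
      zs = filter ∈xs? ys
      dedup : List A → List A
      dedup = deduplicate _≟_
      ⊆zs : xs ⊆ dedup zs
      ⊆zs x∈xs = Equivalence.to (deduplicate-∈⇔ _≟_) (∈-filter⁺ ∈xs? (xs⊆ys x∈xs) x∈xs)
      zs⊆ : dedup zs ⊆ xs
      zs⊆ x∈ = proj₂ (∈-filter⁻ ∈xs? {xs = ys} (Equivalence.from (deduplicate-∈⇔ _≟_) x∈))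

    ∃-∉ : ∀ {xs ys : List A} → Unique xs → length ys ℕ.< length xs → ∃ λ x → x ∈ xs × x ∉ ys
    ∃-∉ {xs} {ys} xs! ys<xs with all? (λ x → ∈? _≟_ x ys) xs
    ... | yes xs⊆ys = ⊥-elim (ℕₚ.<⇒≱ ys<xs (unique-⊆⇒length≤ xs! (All.lookup xs⊆ys)))
    ... | no  xs⊈ys = find (¬All⇒Any¬ (λ x → ∈? _≟_ x ys) xs xs⊈ys)

[1+k]*[1+n]C[1+k]≡[1+n]*nCk : ∀ n k → suc k ℕ.* (suc n C suc k) ≡ suc n ℕ.* (n C k)
[1+k]*[1+n]C[1+k]≡[1+n]*nCk zero    zero    = refl
[1+k]*[1+n]C[1+k]≡[1+n]*nCk zero    (suc k) = begin
  suc (suc k) ℕ.* (1 C suc (suc k))   ≡⟨ cong (suc (suc k) ℕ.*_) (k>n⇒nCk≡0 {1} {suc (suc k)} (ℕ.s≤s (ℕ.s≤s ℕ.z≤n))) ⟩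
  suc (suc k) ℕ.* 0                   ≡⟨ ℕₚ.*-zeroʳ (suc (suc k)) ⟩
  0                                   ≡⟨ cong (1 ℕ.*_) (k>n⇒nCk≡0 {0} {suc k} (ℕ.s≤s ℕ.z≤n)) ⟨
  1 ℕ.* (0 C suc k)                   ∎
  where open ≡-Reasoning
[1+k]*[1+n]C[1+k]≡[1+n]*nCk (suc n) zero    = begin
  1 ℕ.* (suc (suc n) C 1)     ≡⟨ ℕₚ.*-identityˡ _ ⟩
  suc (suc n) C 1             ≡⟨ nC1≡n (suc (suc n)) ⟩
  suc (suc n)                 ≡⟨ ℕₚ.*-identityʳ (suc (suc n)) ⟨
  suc (suc n) ℕ.* 1           ∎
  where open ≡-Reasoning
[1+k]*[1+n]C[1+k]≡[1+n]*nCk (suc n) (suc k) = begin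
  suc K ℕ.* (suc N C suc K)                        ≡⟨ cong (suc K ℕ.*_) (nCk+nC[k+1]≡[n+1]C[k+1] N K) ⟨
  suc K ℕ.* ((N C K) ℕ.+ (N C suc K))              ≡⟨ ℕₚ.*-distribˡ-+ (suc K) (N C K) (N C suc K) ⟩
  ((N C K) ℕ.+ K ℕ.* (N C K)) ℕ.+ suc K ℕ.* (N C suc K)
    ≡⟨ cong₂ (λ u v → ((N C K) ℕ.+ u) ℕ.+ v) ([1+k]*[1+n]C[1+k]≡[1+n]*nCk n k) ([1+k]*[1+n]C[1+k]≡[1+n]*nCk n K) ⟩
  ((N C K) ℕ.+ N ℕ.* (n C k)) ℕ.+ N ℕ.* (n C K)    ≡⟨ ℕₚ.+-assoc (N C K) _ _ ⟩
  (N C K) ℕ.+ (N ℕ.* (n C k) ℕ.+ N ℕ.* (n C K))    ≡⟨ cong ((N C K) ℕ.+_) (ℕₚ.*-distribˡ-+ N (n C k) (n C K)) ⟨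
  (N C K) ℕ.+ N ℕ.* ((n C k) ℕ.+ (n C K))          ≡⟨ cong (λ u → (N C K) ℕ.+ N ℕ.* u) (nCk+nC[k+1]≡[n+1]C[k+1] n k) ⟩
  (N C K) ℕ.+ N ℕ.* (N C K)                        ∎
  where
  open ≡-Reasoning
  N K : ℕ
  N = suc n
  K = suc k

q³≤z*m⇒m≡q×z≡q² : ∀ q {z m} → 0 ℕ.< q → q ℕ.^ 3 ℕ.≤ z ℕ.* m → z ℕ.≤ q ℕ.* q → m ℕ.≤ q → m ≡ q × z ≡ q ℕ.* q
q³≤z*m⇒m≡q×z≡q² q@(suc _) {z} {m} _ q³≤zm z≤q² m≤q = m≡q , ℕₚ.≤-antisym z≤q² q²≤z
  where
  open ℕₚ.≤-Reasoning
  instance _ = ℕₚ.m*n≢0 q q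
  q³≡q²q : q ℕ.^ 3 ≡ q ℕ.* q ℕ.* q
  q³≡q²q = trans (cong (q ℕ.*_) (cong (q ℕ.*_) (ℕₚ.*-identityʳ q))) (sym (ℕₚ.*-assoc q q q))
  m≡q : m ≡ q
  m≡q = ℕₚ.≤-antisym m≤q (ℕₚ.*-cancelˡ-≤ (q ℕ.* q) (begin
    q ℕ.* q ℕ.* q    ≡⟨ q³≡q²q ⟨
    q ℕ.^ 3          ≤⟨ q³≤zm ⟩
    z ℕ.* m          ≤⟨ ℕₚ.*-monoˡ-≤ m z≤q² ⟩
    q ℕ.* q ℕ.* m    ∎))
  q²≤z : q ℕ.* q ℕ.≤ z
  q²≤z = ℕₚ.*-cancelʳ-≤ (q ℕ.* q) z q (begin
    q ℕ.* q ℕ.* q    ≡⟨ q³≡q²q ⟨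
    q ℕ.^ 3          ≤⟨ q³≤zm ⟩
    z ℕ.* m          ≡⟨ cong (z ℕ.*_) m≡q ⟩
    z ℕ.* q          ∎)

prime∣pCk : ∀ {p} → Prime p → ∀ {k} → 0 ℕ.< k → k ℕ.< p → p ∣ p C k
prime∣pCk {suc n} p-prime {suc j} _ j<n
  with euclidsLemma (suc j) (suc n C suc j) p-prime
         (divides (n C j) (trans ([1+k]*[1+n]C[1+k]≡[1+n]*nCk n j) (ℕₚ.*-comm (suc n) (n C j))))
... | inj₁ p∣1+j = ⊥-elim (ℕₚ.<⇒≱ j<n (∣⇒≤ p∣1+j))
... | inj₂ p∣pCk = p∣pCk

module FiniteFieldTheory (F : FiniteField) where

  open FiniteField F
  open RingSolver isCommutativeRing public
    using (commutativeRing; solve; _:+_; _:*_; _:-_; :-_; _:=_; 0ᶜ; 1ᶜ)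
  open CommutativeRing commutativeRing public
    using ( _-_; +-identityˡ; +-identityʳ; -‿inverseˡ; -‿inverseʳ
          ; *-assoc; *-comm; *-identityˡ; *-identityʳ; distribʳ; zeroˡ; zeroʳ
          ; semiring; commutativeSemiring; +-monoid; +-isCommutativeMonoid; *-isCommutativeMonoid)
  open import Algebra.Properties.Ring (CommutativeRing.ring commutativeRing) public
    using (-0#≈0#; -‿involutive; x∙y⁻¹≈ε⇒x≈y; x≈y⇒x∙y⁻¹≈ε; x+x≈x⇒x≈0; +-cancelʳ; +-inverseˡ-unique; +-inverseʳ-unique)
  open import Algebra.Properties.CommutativeSemiring.Exp commutativeSemiring public
    using (_^_; ^-homo-*; ^-assocʳ; ^-distrib-*)
  open import Algebra.Properties.Semiring.Mult semiring public
    using (×1-homo-*; ×-assoc-*) renaming (_×_ to _·_)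
  open import Algebra.Properties.Monoid.Sum +-monoid using (sum; sum-init-last; sum-cong-≗; sum-replicate-zero)
  import Algebra.Properties.CommutativeSemiring.Binomial commutativeSemiring as Binomial
  open ≡-Reasoning

  infix 4 _≟_
  _≟_ : DecidableEquality Carrier
  x ≟ y = map′ index≡⇒≡ (λ { refl → refl }) (index (elems-complete x) Fin.≟ index (elems-complete y))
    where
    index≡⇒≡ : index (elems-complete x) ≡ index (elems-complete y) → x ≡ y
    index≡⇒≡ e = trans (lookup-index (elems-complete x)) (trans (cong (lookup elems) e) (sym (lookup-index (elems-complete y))))

  1≢0 : 1# ≢ 0#
  1≢0 = 0≢1 ∘ sym

  _⁻¹ : ∀ {x} → x ≢ 0# → Carrier
  x≢0 ⁻¹ = proj₁ (inverse _ x≢0)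

  x*x⁻¹≡1 : ∀ {x} (x≢0 : x ≢ 0#) → x * x≢0 ⁻¹ ≡ 1#
  x*x⁻¹≡1 x≢0 = proj₂ (inverse _ x≢0)

  x⁻¹*x≡1 : ∀ {x} (x≢0 : x ≢ 0#) → x≢0 ⁻¹ * x ≡ 1#
  x⁻¹*x≡1 x≢0 = trans (*-comm _ _) (x*x⁻¹≡1 x≢0)

  x⁻¹*[x*y]≡y : ∀ {x} (x≢0 : x ≢ 0#) y → x≢0 ⁻¹ * (x * y) ≡ y
  x⁻¹*[x*y]≡y {x} x≢0 y = begin
    x≢0 ⁻¹ * (x * y)  ≡⟨ *-assoc _ x y ⟨
    x≢0 ⁻¹ * x * y    ≡⟨ cong (_* y) (x⁻¹*x≡1 x≢0) ⟩
    1# * y            ≡⟨ *-identityˡ y ⟩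
    y                 ∎

  x*[x⁻¹*y]≡y : ∀ {x} (x≢0 : x ≢ 0#) y → x * (x≢0 ⁻¹ * y) ≡ y
  x*[x⁻¹*y]≡y {x} x≢0 y = begin
    x * (x≢0 ⁻¹ * y)  ≡⟨ *-assoc x _ y ⟨
    x * x≢0 ⁻¹ * y    ≡⟨ cong (_* y) (x*x⁻¹≡1 x≢0) ⟩
    1# * y            ≡⟨ *-identityˡ y ⟩
    y                 ∎

  y*x⁻¹*x≡y : ∀ {x} (x≢0 : x ≢ 0#) y → y * x≢0 ⁻¹ * x ≡ y
  y*x⁻¹*x≡y {x} x≢0 y = begin
    y * x≢0 ⁻¹ * x      ≡⟨ *-assoc y _ x ⟩
    y * (x≢0 ⁻¹ * x)    ≡⟨ cong (y *_) (x⁻¹*x≡1 x≢0) ⟩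
    y * 1#              ≡⟨ *-identityʳ y ⟩
    y                   ∎

  ad≡bc⇒b≡a*c⁻¹*d : ∀ {a b c d} (c≢0 : c ≢ 0#) → a * d ≡ b * c → b ≡ a * c≢0 ⁻¹ * d
  ad≡bc⇒b≡a*c⁻¹*d {a} {b} {c} {d} c≢0 ad≡bc = begin
    b                   ≡⟨ y*x⁻¹*x≡y c≢0 b ⟨
    b * c≢0 ⁻¹ * c      ≡⟨ solve 3 (λ b i c → b :* i :* c := b :* c :* i) refl b (c≢0 ⁻¹) c ⟩
    b * c * c≢0 ⁻¹      ≡⟨ cong (_* c≢0 ⁻¹) ad≡bc ⟨
    a * d * c≢0 ⁻¹      ≡⟨ solve 3 (λ a d i → a :* d :* i := a :* i :* d) refl a d (c≢0 ⁻¹) ⟩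
    a * c≢0 ⁻¹ * d      ∎

  *-cancelˡ : ∀ {x y z} → x ≢ 0# → x * y ≡ x * z → y ≡ z
  *-cancelˡ {x} {y} {z} x≢0 e = begin
    y                   ≡⟨ x⁻¹*[x*y]≡y x≢0 y ⟨
    x≢0 ⁻¹ * (x * y)    ≡⟨ cong (x≢0 ⁻¹ *_) e ⟩
    x≢0 ⁻¹ * (x * z)    ≡⟨ x⁻¹*[x*y]≡y x≢0 z ⟩
    z                   ∎

  x*y≡0⇒y≡0 : ∀ {x y} → x ≢ 0# → x * y ≡ 0# → y ≡ 0#
  x*y≡0⇒y≡0 {x} x≢0 e = *-cancelˡ x≢0 (trans e (sym (zeroʳ x)))

  *-≢0 : ∀ {x y} → x ≢ 0# → y ≢ 0# → x * y ≢ 0#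
  *-≢0 x≢0 y≢0 = y≢0 ∘ x*y≡0⇒y≡0 x≢0

  ⁻¹-≢0 : ∀ {x} (x≢0 : x ≢ 0#) → x≢0 ⁻¹ ≢ 0#
  ⁻¹-≢0 {x} x≢0 x⁻¹≡0 = 1≢0 (begin
    1#              ≡⟨ x*x⁻¹≡1 x≢0 ⟨
    x * x≢0 ⁻¹      ≡⟨ cong (x *_) x⁻¹≡0 ⟩
    x * 0#          ≡⟨ zeroʳ x ⟩
    0#              ∎)

  -‿≢0 : ∀ {x} → x ≢ 0# → - x ≢ 0#
  -‿≢0 {x} x≢0 -x≡0 = x≢0 (trans (sym (-‿involutive x)) (trans (cong -_ -x≡0) -0#≈0#))

  ^-≢0 : ∀ {x} n → x ≢ 0# → x ^ n ≢ 0#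
  ^-≢0 zero    _   = 1≢0
  ^-≢0 (suc n) x≢0 = *-≢0 x≢0 (^-≢0 n x≢0)

  module _ {P : Carrier → Set} (P? : Decidable P) where

    members : List Carrier
    members = filter P? elems

    members-unique : Unique members
    members-unique = Unique.filter⁺ P? elems-unique

    ∈-members⁺ : ∀ {x} → P x → x ∈ members
    ∈-members⁺ {x} = ∈-filter⁺ P? (elems-complete x)

    ∈-members⁻ : ∀ {x} → x ∈ members → P x
    ∈-members⁻ = proj₂ ∘ ∈-filter⁻ P? {xs = elems}

  open import Data.List.Relation.Binary.Permutation.Setoid.Properties (setoid Carrier)
    using (foldr-commMonoid)

  ∑ ∏ : List Carrier → Carrier
  ∑ = foldr _+_ 0#
  ∏ = foldr _*_ 1#

  ∑-map-+ : ∀ a xs → ∑ (map (_+ a) xs) ≡ ∑ xs + length xs · a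
  ∑-map-+ a []       = sym (+-identityˡ 0#)
  ∑-map-+ a (x ∷ xs) = begin
    (x + a) + ∑ (map (_+ a) xs)         ≡⟨ cong ((x + a) +_) (∑-map-+ a xs) ⟩
    (x + a) + (∑ xs + length xs · a)
      ≡⟨ solve 4 (λ x a s n → (x :+ a) :+ (s :+ n) := (x :+ s) :+ (a :+ n)) refl x a (∑ xs) (length xs · a) ⟩
    (x + ∑ xs) + (a + length xs · a)    ∎

  ∏-map-* : ∀ a xs → ∏ (map (a *_) xs) ≡ a ^ length xs * ∏ xs
  ∏-map-* a []       = sym (*-identityˡ 1#)
  ∏-map-* a (x ∷ xs) = begin
    (a * x) * ∏ (map (a *_) xs)          ≡⟨ cong ((a * x) *_) (∏-map-* a xs) ⟩
    (a * x) * (a ^ length xs * ∏ xs)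
      ≡⟨ solve 4 (λ a x b p → (a :* x) :* (b :* p) := (a :* b) :* (x :* p)) refl a x (a ^ length xs) (∏ xs) ⟩
    (a * a ^ length xs) * (x * ∏ xs)     ∎

  -- Translation by 1 permutes F, so it fixes the sum over F.
  |F|·1≡0 : length elems · 1# ≡ 0#
  |F|·1≡0 = begin
    n · 1#                          ≡⟨ solve 2 (λ s t → t := (s :+ t) :- s) refl (∑ elems) (n · 1#) ⟩
    (∑ elems + n · 1#) - ∑ elems    ≡⟨ cong (_- ∑ elems) (sym (∑-map-+ 1# elems)) ⟩
    ∑ shifted - ∑ elems             ≡⟨ cong (_- ∑ elems) (foldr-commMonoid +-isCommutativeMonoid (↭⇒↭ₛ shifted↭elems)) ⟩
    ∑ elems - ∑ elems               ≡⟨ -‿inverseʳ (∑ elems) ⟩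
    0#                              ∎
    where
    n : ℕ
    n = length elems
    shifted : List Carrier
    shifted = map (_+ 1#) elems
    elems⊆shifted : elems ⊆ shifted
    elems⊆shifted {y} _ = subst (_∈ shifted) (solve 1 (λ y → (y :- 1ᶜ) :+ 1ᶜ := y) refl y)
                            (∈-map⁺ (_+ 1#) (elems-complete (y - 1#)))
    shifted↭elems : shifted ↭ elems
    shifted↭elems = unique-⊆-⊇⇒↭ (Unique.map⁺ (+-cancelʳ 1# _ _) elems-unique) elems-unique
                      (λ {x} _ → elems-complete x) elems⊆shifted

  ≢0? : Decidable (_≢ 0#)
  ≢0? x = ¬? (x ≟ 0#)

  nonzeros : List Carrier
  nonzeros = members ≢0?

  |F|≡1+|F*| : length elems ≡ suc (length nonzeros)
  |F|≡1+|F*| = ↭-length (unique-⊆-⊇⇒↭ elems-unique (0∉nonzeros ∷ members-unique ≢0?) elems⊆ (λ {x} _ → elems-complete x))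
    where
    0∉nonzeros : All.All (0# ≢_) nonzeros
    0∉nonzeros = All.tabulate (λ x∈ 0≡x → ∈-members⁻ ≢0? x∈ (sym 0≡x))
    elems⊆ : elems ⊆ 0# ∷ nonzeros
    elems⊆ {x} _ with x ≟ 0#
    ... | yes x≡0 = here x≡0
    ... | no  x≢0 = there (∈-members⁺ ≢0? x≢0)

  -- Multiplication by a permutes the nonzero elements, so it fixes their product.
  a^|F*|≡1 : ∀ {a} → a ≢ 0# → a ^ length nonzeros ≡ 1#
  a^|F*|≡1 {a} a≢0 = *-cancelˡ (∏-≢0 nonzeros (∈-members⁻ ≢0?)) (begin
    ∏ nonzeros * a ^ length nonzeros  ≡⟨ *-comm _ _ ⟩
    a ^ length nonzeros * ∏ nonzeros  ≡⟨ ∏-map-* a nonzeros ⟨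
    ∏ (map (a *_) nonzeros)           ≡⟨ foldr-commMonoid *-isCommutativeMonoid (↭⇒↭ₛ scaled↭nonzeros) ⟩
    ∏ nonzeros                        ≡⟨ *-identityʳ _ ⟨
    ∏ nonzeros * 1#                   ∎)
    where
    ∏-≢0 : ∀ xs → (∀ {x} → x ∈ xs → x ≢ 0#) → ∏ xs ≢ 0#
    ∏-≢0 []       _     = 1≢0
    ∏-≢0 (x ∷ xs) xs≢0 = *-≢0 (xs≢0 (here refl)) (∏-≢0 xs (xs≢0 ∘ there))
    scaled⊆ : map (a *_) nonzeros ⊆ nonzeros
    scaled⊆ y∈ with ∈-map⁻ (a *_) y∈
    ... | x , x∈ , refl = ∈-members⁺ ≢0? (*-≢0 a≢0 (∈-members⁻ ≢0? x∈))
    ⊆scaled : nonzeros ⊆ map (a *_) nonzeros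
    ⊆scaled {y} y∈ = subst (_∈ map (a *_) nonzeros) (x*[x⁻¹*y]≡y a≢0 y)
                       (∈-map⁺ (a *_) (∈-members⁺ ≢0? (*-≢0 (⁻¹-≢0 a≢0) (∈-members⁻ ≢0? y∈))))
    scaled↭nonzeros : map (a *_) nonzeros ↭ nonzeros
    scaled↭nonzeros = unique-⊆-⊇⇒↭ (Unique.map⁺ (*-cancelˡ a≢0) (members-unique ≢0?)) (members-unique ≢0?) scaled⊆ ⊆scaled

  a^|F|≡a : ∀ a → a ^ length elems ≡ a
  a^|F|≡a a rewrite |F|≡1+|F*| with a ≟ 0#
  ... | yes refl = zeroˡ _
  ... | no  a≢0  = trans (cong (a *_) (a^|F*|≡1 a≢0)) (*-identityʳ a)

  -- f is a polynomial function of degree ≤ d with coefficient c at x^d, presented through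
  -- the factor theorem: f x = f a + (x - a) * g x with g of degree ≤ d - 1.
  Polynomial : ℕ → Carrier → (Carrier → Carrier) → Set
  Polynomial zero    c f = ∀ x → f x ≡ c
  Polynomial (suc d) c f = ∀ a → Σ (Carrier → Carrier) λ g → Polynomial d c g × (∀ x → f x ≡ f a + (x - a) * g x)

  Polynomial-resp : ∀ d {c f g} → (∀ x → f x ≡ g x) → Polynomial d c f → Polynomial d c g
  Polynomial-resp zero    f≗g P x = trans (sym (f≗g x)) (P x)
  Polynomial-resp (suc d) {f = f} {g} f≗g P a with P a
  ... | h , H , f≡ = h , H , λ x → begin
    g x                    ≡⟨ f≗g x ⟨
    f x                    ≡⟨ f≡ x ⟩
    f a + (x - a) * h x    ≡⟨ cong (_+ (x - a) * h x) (f≗g a) ⟩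
    g a + (x - a) * h x    ∎

  Polynomial-+ : ∀ d {c c′ f g} → Polynomial d c f → Polynomial d c′ g → Polynomial d (c + c′) (λ x → f x + g x)
  Polynomial-+ zero    P Q x = cong₂ _+_ (P x) (Q x)
  Polynomial-+ (suc d) {f = f} {g} P Q a with P a | Q a
  ... | h , H , f≡ | k , K , g≡ = (λ x → h x + k x) , Polynomial-+ d H K , λ x → begin
    f x + g x                                          ≡⟨ cong₂ _+_ (f≡ x) (g≡ x) ⟩
    (f a + (x - a) * h x) + (g a + (x - a) * k x)
      ≡⟨ solve 6 (λ fa ga x a u v → (fa :+ (x :- a) :* u) :+ (ga :+ (x :- a) :* v) := (fa :+ ga) :+ (x :- a) :* (u :+ v))
           refl (f a) (g a) x a (h x) (k x) ⟩
    (f a + g a) + (x - a) * (h x + k x)                ∎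

  Polynomial-* : ∀ d {c f} k → Polynomial d c f → Polynomial d (k * c) (λ x → k * f x)
  Polynomial-* zero    k P x = cong (k *_) (P x)
  Polynomial-* (suc d) {f = f} k P a with P a
  ... | h , H , f≡ = (λ x → k * h x) , Polynomial-* d k H , λ x → begin
    k * f x                        ≡⟨ cong (k *_) (f≡ x) ⟩
    k * (f a + (x - a) * h x)
      ≡⟨ solve 5 (λ k fa x a u → k :* (fa :+ (x :- a) :* u) := k :* fa :+ (x :- a) :* (k :* u)) refl k (f a) x a (h x) ⟩
    k * f a + (x - a) * (k * h x)  ∎

  Polynomial-suc : ∀ d {c f} → Polynomial d c f → Polynomial (suc d) 0# f
  Polynomial-suc zero    {f = f} P a = (λ _ → 0#) , (λ _ → refl) , λ x → begin
    f x                        ≡⟨ trans (P x) (sym (P a)) ⟩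
    f a                        ≡⟨ solve 3 (λ fa x a → fa := fa :+ (x :- a) :* 0ᶜ) refl (f a) x a ⟩
    f a + (x - a) * 0#         ∎
  Polynomial-suc (suc d) P a with P a
  ... | h , H , f≡ = h , Polynomial-suc d H , f≡

  Polynomial-raise : ∀ {d c f} D → Polynomial d c f → d ℕ.< D → Polynomial D 0# f
  Polynomial-raise {d} (suc D) P (ℕ.s≤s d≤D) with ℕₚ.m≤n⇒m<n∨m≡n d≤D
  ... | inj₁ d<D  = Polynomial-suc D (Polynomial-raise D P d<D)
  ... | inj₂ refl = Polynomial-suc d P

  Polynomial-+-lower : ∀ {d e c c′ f g} → Polynomial d c f → Polynomial e c′ g → e ℕ.< d →
                       Polynomial d c (λ x → f x + g x)
  Polynomial-+-lower {d} {c = c} P Q e<d =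
    subst (λ c → Polynomial d c _) (+-identityʳ c) (Polynomial-+ d P (Polynomial-raise d Q e<d))

  Polynomial-x* : ∀ d {c f} → Polynomial d c f → Polynomial (suc d) c (λ x → x * f x)
  Polynomial-x* zero    {c} {f} P a = f , P , λ x → begin
    x * f x                    ≡⟨ cong (x *_) (P x) ⟩
    x * c                      ≡⟨ solve 3 (λ c x a → x :* c := a :* c :+ (x :- a) :* c) refl c x a ⟩
    a * c + (x - a) * c        ≡⟨ cong₂ (λ u v → a * u + (x - a) * v) (P a) (P x) ⟨
    a * f a + (x - a) * f x    ∎
  Polynomial-x* (suc d) {c} {f} P a with P a
  ... | h , H , f≡ = (λ x → f x + a * h x) , Polynomial-+-lower P (Polynomial-* d a H) (ℕₚ.n<1+n d) , λ x → begin
    x * f x                                     ≡⟨ cong (x *_) (f≡ x) ⟩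
    x * (f a + (x - a) * h x)
      ≡⟨ solve 4 (λ x a fa u → x :* (fa :+ (x :- a) :* u) := a :* fa :+ (x :- a) :* ((fa :+ (x :- a) :* u) :+ a :* u)) refl x a (f a) (h x) ⟩
    a * f a + (x - a) * ((f a + (x - a) * h x) + a * h x) ≡⟨ cong (λ u → a * f a + (x - a) * (u + a * h x)) (f≡ x) ⟨
    a * f a + (x - a) * (f x + a * h x)         ∎

  Polynomial-^ : ∀ m → Polynomial m 1# (_^ m)
  Polynomial-^ zero    x = refl
  Polynomial-^ (suc m) = Polynomial-x* m (Polynomial-^ m)

  roots≤degree : ∀ d {c f} → Polynomial d c f → c ≢ 0# → ∀ {rs} → Unique rs →
                 (∀ {r} → r ∈ rs → f r ≡ 0#) → length rs ℕ.≤ d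
  roots≤degree d       P c≢0 {[]}     _          _     = ℕ.z≤n
  roots≤degree zero    P c≢0 {r ∷ rs} _          roots = ⊥-elim (c≢0 (trans (sym (P r)) (roots (here refl))))
  roots≤degree (suc d) {f = f} P c≢0 {a ∷ rs} (a∉ ∷ rs!) roots with P a
  ... | g , G , f≡ = ℕ.s≤s (roots≤degree d G c≢0 rs! g-roots)
    where
    g-roots : ∀ {r} → r ∈ rs → g r ≡ 0#
    g-roots {r} r∈ = x*y≡0⇒y≡0 (λ r-a≡0 → All.lookup a∉ r∈ (sym (x∙y⁻¹≈ε⇒x≈y r a r-a≡0))) (begin
      (r - a) * g r           ≡⟨ +-identityˡ _ ⟨
      0# + (r - a) * g r      ≡⟨ cong (_+ (r - a) * g r) (roots (here refl)) ⟨
      f a + (r - a) * g r     ≡⟨ f≡ r ⟨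
      f r                     ≡⟨ roots (there r∈) ⟩
      0#                      ∎)

  ·1-homo-^ : ∀ m n → (m ℕ.^ n) · 1# ≡ (m · 1#) ^ n
  ·1-homo-^ m zero    = +-identityʳ 1#
  ·1-homo-^ m (suc n) = trans (×1-homo-* m (m ℕ.^ n)) (cong ((m · 1#) *_) (·1-homo-^ m n))

  characteristic : ∀ {p n} → length elems ≡ p ℕ.^ suc n → p · 1# ≡ 0#
  characteristic {p} {n} |F|≡pⁿ⁺¹ with p · 1# ≟ 0#
  ... | yes p·1≡0 = p·1≡0
  ... | no  p·1≢0 = ⊥-elim (^-≢0 (suc n) p·1≢0 (begin
    (p · 1#) ^ suc n       ≡⟨ ·1-homo-^ p (suc n) ⟨
    (p ℕ.^ suc n) · 1#     ≡⟨ cong (_· 1#) |F|≡pⁿ⁺¹ ⟨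
    length elems · 1#      ≡⟨ |F|·1≡0 ⟩
    0#                     ∎))

  pCk·x≡0 : ∀ {p} → Prime p → p · 1# ≡ 0# → ∀ {k} → 0 ℕ.< k → k ℕ.< p → ∀ x → (p C k) · x ≡ 0#
  pCk·x≡0 {p} p-prime p·1≡0 {k} 0<k k<p x with prime∣pCk p-prime 0<k k<p
  ... | divides c pCk≡c*p = begin
    (p C k) · x                  ≡⟨ cong (_· x) pCk≡c*p ⟩
    (c ℕ.* p) · x                ≡⟨ cong ((c ℕ.* p) ·_) (*-identityˡ x) ⟨
    (c ℕ.* p) · (1# * x)         ≡⟨ ×-assoc-* (c ℕ.* p) 1# x ⟨
    ((c ℕ.* p) · 1#) * x         ≡⟨ cong (_* x) (×1-homo-* c p) ⟩
    ((c · 1#) * (p · 1#)) * x    ≡⟨ cong (λ u → ((c · 1#) * u) * x) p·1≡0 ⟩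
    ((c · 1#) * 0#) * x          ≡⟨ solve 2 (λ a x → (a :* 0ᶜ) :* x := 0ᶜ) refl (c · 1#) x ⟩
    0#                           ∎

  frobenius : ∀ {p} → Prime p → p · 1# ≡ 0# → ∀ x y → (x + y) ^ p ≡ x ^ p + y ^ p
  frobenius {0}           p-prime = ⊥-elim (¬prime[0] p-prime)
  frobenius {1}           p-prime = ⊥-elim (¬prime[1] p-prime)
  frobenius {suc (suc m)} p-prime p·1≡0 x y = begin
    (x + y) ^ p                                        ≡⟨ Binomial.theorem p x y ⟩
    t 0F + sum (tail t)                                ≡⟨ cong (t 0F +_) (sum-init-last (tail t)) ⟩
    t 0F + (sum (init (tail t)) + last (tail t))       ≡⟨ cong (λ s → t 0F + (s + last (tail t))) middle≡0 ⟩
    t 0F + (0# + last (tail t))                        ≡⟨ cong₂ (λ u v → u + (0# + v)) first last′ ⟩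
    y ^ p + (0# + x ^ p)                               ≡⟨ solve 2 (λ u v → u :+ (0ᶜ :+ v) := v :+ u) refl (y ^ p) (x ^ p) ⟩
    x ^ p + y ^ p                                      ∎
    where
    p : ℕ
    p = suc (suc m)
    t : Fin (suc p) → Carrier
    t = Binomial.binomialTerm x y p
    middle≡0 : sum (init (tail t)) ≡ 0#
    middle≡0 = trans (sum-cong-≗ middle-term≡0) (sum-replicate-zero (suc m))
      where
      middle-term≡0 : ∀ i → t (Fin.suc (Fin.inject₁ i)) ≡ 0#
      middle-term≡0 i = pCk·x≡0 p-prime p·1≡0 ℕ.z<s (ℕ.s≤s (Finₚ.inject₁ℕ< i)) (Binomial.binomial x y p (Fin.suc (Fin.inject₁ i)))
    first : t 0F ≡ y ^ p
    first = trans (+-identityʳ _) (*-identityˡ _)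
    last′ : last (tail t) ≡ x ^ p
    last′ = begin
      (p C suc (toℕ (fromℕ (suc m)))) · (x ^ suc (toℕ (fromℕ (suc m))) * y ^ (p ℕ.∸ suc (toℕ (fromℕ (suc m)))))
        ≡⟨ cong (λ j → (p C j) · (x ^ j * y ^ (p ℕ.∸ j))) (cong suc (Finₚ.toℕ-fromℕ (suc m))) ⟩
      (p C p) · (x ^ p * y ^ (p ℕ.∸ p))   ≡⟨ cong₂ (λ c j → c · (x ^ p * y ^ j)) (nCn≡1 p) (ℕₚ.n∸n≡0 p) ⟩
      1 · (x ^ p * 1#)                    ≡⟨ trans (+-identityʳ _) (*-identityʳ _) ⟩
      x ^ p                               ∎

module CubicExtension (F : FiniteField) (p k : ℕ) (p-prime : Prime p)
  (|F|≡q³ : length (FiniteField.elems F) ≡ (p ℕ.^ suc k) ℕ.^ 3) where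

  open FiniteField F
  open FiniteFieldTheory F
  open ≡-Reasoning

  q : ℕ
  q = p ℕ.^ suc k

  2≤q : 2 ℕ.≤ q
  2≤q = ℕₚ.≤-trans 2≤p (ℕₚ.m≤m*n p (p ℕ.^ k))
    where
    instance
      p≢0 : ℕ.NonZero p
      p≢0 = prime⇒nonZero p-prime
      pᵏ≢0 : ℕ.NonZero (p ℕ.^ k)
      pᵏ≢0 = ℕ.>-nonZero (ℕₚ.m^n>0 p k)
    2≤p : 2 ℕ.≤ p
    2≤p = ℕ.nonTrivial⇒n>1 p {{prime⇒nonTrivial p-prime}}

  φ : Carrier → Carrier
  φ x = x ^ q

  p·1≡0 : p · 1# ≡ 0#
  p·1≡0 = characteristic {p} {2 ℕ.+ k ℕ.* 3} (trans |F|≡q³ (ℕₚ.^-*-assoc p (suc k) 3))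

  p^j-additive : ∀ j x y → (x + y) ^ (p ℕ.^ j) ≡ x ^ (p ℕ.^ j) + y ^ (p ℕ.^ j)
  p^j-additive zero    x y = distribʳ 1# x y
  p^j-additive (suc j) x y = begin
    (x + y) ^ (p ℕ.* p ℕ.^ j)                 ≡⟨ ^-assocʳ (x + y) p (p ℕ.^ j) ⟨
    ((x + y) ^ p) ^ (p ℕ.^ j)                 ≡⟨ cong (_^ (p ℕ.^ j)) (frobenius p-prime p·1≡0 x y) ⟩
    (x ^ p + y ^ p) ^ (p ℕ.^ j)               ≡⟨ p^j-additive j (x ^ p) (y ^ p) ⟩
    (x ^ p) ^ (p ℕ.^ j) + (y ^ p) ^ (p ℕ.^ j) ≡⟨ cong₂ _+_ (^-assocʳ x p (p ℕ.^ j)) (^-assocʳ y p (p ℕ.^ j)) ⟩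
    x ^ (p ℕ.* p ℕ.^ j) + y ^ (p ℕ.* p ℕ.^ j) ∎

  φ-+ : ∀ x y → φ (x + y) ≡ φ x + φ y
  φ-+ = p^j-additive (suc k)

  φ-* : ∀ x y → φ (x * y) ≡ φ x * φ y
  φ-* x y = ^-distrib-* x y q

  φ-0 : φ 0# ≡ 0#
  φ-0 = x+x≈x⇒x≈0 (φ 0#) (trans (sym (φ-+ 0# 0#)) (cong φ (+-identityˡ 0#)))

  φ-1 : φ 1# ≡ 1#
  φ-1 = 1^n≡1 q
    where
    1^n≡1 : ∀ n → 1# ^ n ≡ 1#
    1^n≡1 zero    = refl
    1^n≡1 (suc n) = trans (*-identityˡ _) (1^n≡1 n)

  φ-‿ : ∀ x → φ (- x) ≡ - φ x
  φ-‿ x = +-inverseˡ-unique (φ (- x)) (φ x) (begin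
    φ (- x) + φ x   ≡⟨ φ-+ (- x) x ⟨
    φ (- x + x)     ≡⟨ cong φ (-‿inverseˡ x) ⟩
    φ 0#            ≡⟨ φ-0 ⟩
    0#              ∎)

  φ-- : ∀ x y → φ (x - y) ≡ φ x - φ y
  φ-- x y = trans (φ-+ x (- y)) (cong (φ x +_) (φ-‿ y))

  φ³≡id : ∀ x → φ (φ (φ x)) ≡ x
  φ³≡id x = begin
    ((x ^ q) ^ q) ^ q      ≡⟨ cong (_^ q) (^-assocʳ x q q) ⟩
    (x ^ (q ℕ.* q)) ^ q    ≡⟨ ^-assocʳ x (q ℕ.* q) q ⟩
    x ^ (q ℕ.* q ℕ.* q)    ≡⟨ cong (x ^_) q*q*q≡|F| ⟩
    x ^ length elems       ≡⟨ a^|F|≡a x ⟩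
    x                      ∎
    where
    q*q*q≡|F| : q ℕ.* q ℕ.* q ≡ length elems
    q*q*q≡|F| = trans (trans (ℕₚ.*-assoc q q q) (cong (λ n → q ℕ.* (q ℕ.* n)) (sym (ℕₚ.*-identityʳ q)))) (sym |F|≡q³)

  φ-injective : ∀ {x y} → φ x ≡ φ y → x ≡ y
  φ-injective {x} {y} φx≡φy = trans (sym (φ³≡id x)) (trans (cong (φ ∘ φ) φx≡φy) (φ³≡id y))

  φ-≢0 : ∀ {x} → x ≢ 0# → φ x ≢ 0#
  φ-≢0 x≢0 φx≡0 = x≢0 (φ-injective (trans φx≡0 (sym φ-0)))

  𝔽q : Carrier → Set
  𝔽q x = φ x ≡ x

  𝔽q-* : ∀ {a b} → 𝔽q a → 𝔽q b → 𝔽q (a * b)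
  𝔽q-* {a} {b} φa≡a φb≡b = trans (φ-* a b) (cong₂ _*_ φa≡a φb≡b)

  φ-⁻¹ : ∀ {a} (a≢0 : a ≢ 0#) → φ (a≢0 ⁻¹) * φ a ≡ 1#
  φ-⁻¹ {a} a≢0 = trans (sym (φ-* (a≢0 ⁻¹) a)) (trans (cong φ (x⁻¹*x≡1 a≢0)) φ-1)

  𝔽q-⁻¹ : ∀ {a} (a≢0 : a ≢ 0#) → 𝔽q a → 𝔽q (a≢0 ⁻¹)
  𝔽q-⁻¹ {a} a≢0 φa≡a = *-cancelˡ a≢0 (begin
    a * φ (a≢0 ⁻¹)       ≡⟨ cong (_* φ (a≢0 ⁻¹)) φa≡a ⟨
    φ a * φ (a≢0 ⁻¹)     ≡⟨ trans (*-comm _ _) (φ-⁻¹ a≢0) ⟩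
    1#                   ≡⟨ x*x⁻¹≡1 a≢0 ⟨
    a * a≢0 ⁻¹           ∎)

  φ-𝔽q-* : ∀ {a} x → 𝔽q a → φ (a * x) ≡ a * φ x
  φ-𝔽q-* {a} x φa≡a = trans (φ-* a x) (cong (_* φ x) φa≡a)

  Tr : Carrier → Carrier
  Tr x = x + φ x + φ (φ x)

  Tr-+ : ∀ x y → Tr (x + y) ≡ Tr x + Tr y
  Tr-+ x y = begin
    (x + y) + φ (x + y) + φ (φ (x + y))
      ≡⟨ cong₂ (λ u v → (x + y) + u + v) (φ-+ x y) (trans (cong φ (φ-+ x y)) (φ-+ (φ x) (φ y))) ⟩
    (x + y) + (φ x + φ y) + (φ (φ x) + φ (φ y))
      ≡⟨ solve 6 (λ x y a b c d → (x :+ y) :+ (a :+ b) :+ (c :+ d) := (x :+ a :+ c) :+ (y :+ b :+ d)) refl x y (φ x) (φ y) (φ (φ x)) (φ (φ y)) ⟩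
    (x + φ x + φ (φ x)) + (y + φ y + φ (φ y))             ∎

  Tr-𝔽q-* : ∀ {a} x → 𝔽q a → Tr (a * x) ≡ a * Tr x
  Tr-𝔽q-* {a} x φa≡a = begin
    a * x + φ (a * x) + φ (φ (a * x))
      ≡⟨ cong₂ (λ u v → a * x + u + v) (φ-𝔽q-* x φa≡a) (trans (cong φ (φ-𝔽q-* x φa≡a)) (φ-𝔽q-* (φ x) φa≡a)) ⟩
    a * x + a * φ x + a * φ (φ x)
      ≡⟨ solve 4 (λ a x b c → a :* x :+ a :* b :+ a :* c := a :* (x :+ b :+ c)) refl a x (φ x) (φ (φ x)) ⟩
    a * (x + φ x + φ (φ x))                          ∎

  Tr-φ-- : ∀ y → Tr (φ y - y) ≡ 0#
  Tr-φ-- y = begin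
    (φ y - y) + φ (φ y - y) + φ (φ (φ y - y))
      ≡⟨ cong₂ (λ u v → (φ y - y) + u + v) (φ-- (φ y) y) (trans (cong φ (φ-- (φ y) y)) (φ-- (φ (φ y)) (φ y))) ⟩
    (φ y - y) + (φ (φ y) - φ y) + (φ (φ (φ y)) - φ (φ y))
      ≡⟨ cong (λ u → (φ y - y) + (φ (φ y) - φ y) + (u - φ (φ y))) (φ³≡id y) ⟩
    (φ y - y) + (φ (φ y) - φ y) + (y - φ (φ y))
      ≡⟨ solve 3 (λ y a b → (a :- y) :+ (b :- a) :+ (y :- b) := 0ᶜ) refl y (φ y) (φ (φ y)) ⟩
    0#                                                            ∎

  _∧_ : Carrier → Carrier → Carrier
  x ∧ y = x * φ y - φ x * y

  ∧-self : ∀ x → x ∧ x ≡ 0#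
  ∧-self x = trans (cong (λ u → x * φ x - u) (*-comm (φ x) x)) (-‿inverseʳ (x * φ x))

  ∧-𝔽q-*ˡ : ∀ {a} x y → 𝔽q a → (a * x) ∧ y ≡ a * (x ∧ y)
  ∧-𝔽q-*ˡ {a} x y φa≡a = begin
    (a * x) * φ y - φ (a * x) * y      ≡⟨ cong (λ u → (a * x) * φ y - u * y) (φ-𝔽q-* x φa≡a) ⟩
    (a * x) * φ y - (a * φ x) * y
      ≡⟨ solve 5 (λ a x y b c → (a :* x) :* b :- (a :* c) :* y := a :* (x :* b :- c :* y)) refl a x y (φ y) (φ x) ⟩
    a * (x * φ y - φ x * y)            ∎

  ∧-𝔽q-*ʳ : ∀ {a} x y → 𝔽q a → x ∧ (a * y) ≡ a * (x ∧ y)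
  ∧-𝔽q-*ʳ {a} x y φa≡a = begin
    x * φ (a * y) - φ x * (a * y)      ≡⟨ cong (λ u → x * u - φ x * (a * y)) (φ-𝔽q-* y φa≡a) ⟩
    x * (a * φ y) - φ x * (a * y)
      ≡⟨ solve 5 (λ a x y b c → x :* (a :* b) :- c :* (a :* y) := a :* (x :* b :- c :* y)) refl a x y (φ y) (φ x) ⟩
    a * (x * φ y - φ x * y)            ∎

  ∧-+ˡ : ∀ x y z → (x + y) ∧ z ≡ x ∧ z + y ∧ z
  ∧-+ˡ x y z = begin
    (x + y) * φ z - φ (x + y) * z      ≡⟨ cong (λ u → (x + y) * φ z - u * z) (φ-+ x y) ⟩
    (x + y) * φ z - (φ x + φ y) * z
      ≡⟨ solve 6 (λ x y z a b c → (x :+ y) :* c :- (a :+ b) :* z := (x :* c :- a :* z) :+ (y :* c :- b :* z)) refl x y z (φ x) (φ y) (φ z) ⟩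
    x ∧ z + y ∧ z                      ∎

  ∧-+ʳ : ∀ x y z → x ∧ (y + z) ≡ x ∧ y + x ∧ z
  ∧-+ʳ x y z = begin
    x * φ (y + z) - φ x * (y + z)      ≡⟨ cong (λ u → x * u - φ x * (y + z)) (φ-+ y z) ⟩
    x * (φ y + φ z) - φ x * (y + z)
      ≡⟨ solve 6 (λ x y z a b c → x :* (b :+ c) :- a :* (y :+ z) := (x :* b :- a :* y) :+ (x :* c :- a :* z)) refl x y z (φ x) (φ y) (φ z) ⟩
    x ∧ y + x ∧ z                      ∎

  0∧x≡0 : ∀ x → 0# ∧ x ≡ 0#
  0∧x≡0 x = begin
    0# * φ x - φ 0# * x    ≡⟨ cong (λ u → 0# * φ x - u * x) φ-0 ⟩
    0# * φ x - 0# * x      ≡⟨ solve 2 (λ x a → 0ᶜ :* a :- 0ᶜ :* x := 0ᶜ) refl x (φ x) ⟩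
    0#                     ∎

  φ-∧ : ∀ x y → φ (x ∧ y) ≡ φ x ∧ φ y
  φ-∧ x y = trans (φ-- _ _) (cong₂ _-_ (φ-* x (φ y)) (φ-* (φ x) y))

  cramer : ∀ x y s → (x ∧ y) * s ≡ (s ∧ y) * x + (x ∧ s) * y
  cramer x y s = solve 6 (λ x y s a b c → (x :* b :- a :* y) :* s := (s :* b :- c :* y) :* x :+ (x :* c :- a :* s) :* y)
                   refl x y s (φ x) (φ y) (φ s)

  ∧-trace-zero : ∀ {x y} → Tr x ≡ 0# → Tr y ≡ 0# → 𝔽q (x ∧ y)
  ∧-trace-zero {x} {y} Trx≡0 Try≡0 = begin
    φ (x ∧ y)                              ≡⟨ φ-∧ x y ⟩
    φ x * φ (φ y) - φ (φ x) * φ y          ≡⟨ cong₂ (λ u v → φ x * u - v * φ y) (φφ≡ Try≡0) (φφ≡ Trx≡0) ⟩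
    φ x * - (y + φ y) - - (x + φ x) * φ y
      ≡⟨ solve 4 (λ x y a b → a :* :- (y :+ b) :- :- (x :+ a) :* b := x :* b :- a :* y) refl x y (φ x) (φ y) ⟩
    x * φ y - φ x * y                      ∎
    where
    φφ≡ : ∀ {z} → Tr z ≡ 0# → φ (φ z) ≡ - (z + φ z)
    φφ≡ {z} Trz≡0 = +-inverseʳ-unique (z + φ z) (φ (φ z)) Trz≡0

  ∧≡0⇒𝔽q-ratio : ∀ {x y} (x≢0 : x ≢ 0#) → x ∧ y ≡ 0# → 𝔽q (y * x≢0 ⁻¹)
  ∧≡0⇒𝔽q-ratio {x} {y} x≢0 x∧y≡0 = *-cancelˡ (*-≢0 x≢0 (φ-≢0 x≢0)) (begin
    (x * φ x) * φ (y * x≢0 ⁻¹)             ≡⟨ cong ((x * φ x) *_) (φ-* y (x≢0 ⁻¹)) ⟩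
    (x * φ x) * (φ y * φ (x≢0 ⁻¹))
      ≡⟨ solve 4 (λ x a b c → (x :* a) :* (b :* c) := (x :* b) :* (c :* a)) refl x (φ x) (φ y) (φ (x≢0 ⁻¹)) ⟩
    (x * φ y) * (φ (x≢0 ⁻¹) * φ x)         ≡⟨ cong₂ _*_ (x∙y⁻¹≈ε⇒x≈y _ _ x∧y≡0) (φ-⁻¹ x≢0) ⟩
    (φ x * y) * 1#                         ≡⟨ cong ((φ x * y) *_) (x*x⁻¹≡1 x≢0) ⟨
    (φ x * y) * (x * x≢0 ⁻¹)
      ≡⟨ solve 4 (λ x a y i → (a :* y) :* (x :* i) := (x :* a) :* (y :* i)) refl x (φ x) y (x≢0 ⁻¹) ⟩
    (x * φ x) * (y * x≢0 ⁻¹)               ∎)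

  𝔽q? : Decidable 𝔽q
  𝔽q? x = φ x ≟ x

  Tr≡0? : Decidable (λ x → Tr x ≡ 0#)
  Tr≡0? x = Tr x ≟ 0#

  𝔽q-elements : List Carrier
  𝔽q-elements = members 𝔽q?

  trace-zeros : List Carrier
  trace-zeros = members Tr≡0?

  q<q*q : q ℕ.< q ℕ.* q
  q<q*q = ℕₚ.m<m*n q q {{ℕ.>-nonZero (ℕₚ.<-trans ℕ.z<s 2≤q)}} 2≤q

  |𝔽q|≤q : length 𝔽q-elements ℕ.≤ q
  |𝔽q|≤q = roots≤degree q φx-x 1≢0 (members-unique 𝔽q?) (x≈y⇒x∙y⁻¹≈ε ∘ ∈-members⁻ 𝔽q?)
    where
    φx-x : Polynomial q 1# (λ x → φ x - x)
    φx-x = Polynomial-resp q (λ x → cong (φ x +_) (solve 1 (λ x → :- 1ᶜ :* (x :* 1ᶜ) := :- x) refl x))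
             (Polynomial-+-lower (Polynomial-^ q) (Polynomial-* 1 (- 1#) (Polynomial-^ 1)) 2≤q)

  |Z|≤q² : length trace-zeros ℕ.≤ q ℕ.* q
  |Z|≤q² = roots≤degree (q ℕ.* q) trace 1≢0 (members-unique Tr≡0?) (∈-members⁻ Tr≡0?)
    where
    trace : Polynomial (q ℕ.* q) 1# Tr
    trace = Polynomial-resp (q ℕ.* q) (λ x → begin
        x ^ (q ℕ.* q) + (x ^ q + x * 1#)     ≡⟨ cong (_+ (x ^ q + x * 1#)) (^-assocʳ x q q) ⟨
        φ (φ x) + (φ x + x * 1#)             ≡⟨ solve 3 (λ x a b → b :+ (a :+ x :* 1ᶜ) := x :+ a :+ b) refl x (φ x) (φ (φ x)) ⟩
        Tr x                                 ∎)
      (Polynomial-+-lower (Polynomial-^ (q ℕ.* q)) (Polynomial-+-lower (Polynomial-^ q) (Polynomial-^ 1) 2≤q) q<q*q)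

  |F|≤|Z|*|𝔽q| : length elems ℕ.≤ length trace-zeros ℕ.* length 𝔽q-elements
  |F|≤|Z|*|𝔽q| = ℕₚ.≤-trans (unique-⊆⇒length≤ _≟_ elems-unique elems⊆cover)
                   (ℕₚ.≤-reflexive (length-cartesianProductWith _ trace-zeros 𝔽q-elements))
    where
    ψ : Carrier → Carrier
    ψ y = φ y - y
    -- some y with ψ y ≡ z, or 0# when there is none
    preimage : Carrier → Carrier
    preimage z with any? (λ y → ψ y ≟ z) elems
    ... | yes ∃y = proj₁ (satisfied ∃y)
    ... | no  _  = 0#
    ψ-preimage : ∀ y → ψ (preimage (ψ y)) ≡ ψ y
    ψ-preimage y with any? (λ y′ → ψ y′ ≟ ψ y) elems
    ... | yes ∃y = proj₂ (satisfied ∃y)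
    ... | no  ∄y = ⊥-elim (∄y (Any.map (λ y≡ → cong ψ (sym y≡)) (elems-complete y)))
    cover : List Carrier
    cover = cartesianProductWith (λ z t → preimage z + t) trace-zeros 𝔽q-elements
    elems⊆cover : elems ⊆ cover
    elems⊆cover {y} _ = subst (_∈ cover) (solve 2 (λ a y → a :+ (y :- a) := y) refl (preimage (ψ y)) y)
      (∈-cartesianProductWith⁺ (λ z t → preimage z + t) (∈-members⁺ Tr≡0? (Tr-φ-- y)) (∈-members⁺ 𝔽q? φt≡t))
      where
      t : Carrier
      t = y - preimage (ψ y)
      φt≡t : 𝔽q t
      φt≡t = x∙y⁻¹≈ε⇒x≈y _ _ (begin
        φ t - t                                            ≡⟨ cong (_- t) (φ-- y (preimage (ψ y))) ⟩
        (φ y - φ (preimage (ψ y))) - t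
          ≡⟨ solve 4 (λ y a b c → (b :- c) :- (y :- a) := (b :- y) :- (c :- a)) refl y (preimage (ψ y)) (φ y) (φ (preimage (ψ y))) ⟩
        ψ y - ψ (preimage (ψ y))                           ≡⟨ x≈y⇒x∙y⁻¹≈ε (sym (ψ-preimage y)) ⟩
        0#                                                 ∎)

  |𝔽q|≡q×|Z|≡q² : length 𝔽q-elements ≡ q × length trace-zeros ≡ q ℕ.* q
  |𝔽q|≡q×|Z|≡q² = q³≤z*m⇒m≡q×z≡q² q {length trace-zeros} {length 𝔽q-elements} (ℕₚ.<-trans ℕ.z<s 2≤q)
                    (subst (ℕ._≤ length trace-zeros ℕ.* length 𝔽q-elements) |F|≡q³ |F|≤|Z|*|𝔽q|) |Z|≤q² |𝔽q|≤q

  |𝔽q|≡q : length 𝔽q-elements ≡ q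
  |𝔽q|≡q = proj₁ |𝔽q|≡q×|Z|≡q²

  |Z|≡q² : length trace-zeros ≡ q ℕ.* q
  |Z|≡q² = proj₂ |𝔽q|≡q×|Z|≡q²

  1<|Z| : 1 ℕ.< length trace-zeros
  1<|Z| = subst (1 ℕ.<_) (sym |Z|≡q²) (ℕₚ.<-trans 2≤q q<q*q)

  |𝔽q·x|<|Z| : ∀ x → length (map (_* x) 𝔽q-elements) ℕ.< length trace-zeros
  |𝔽q·x|<|Z| x = subst₂ ℕ._<_ (sym (trans (length-map (_* x) 𝔽q-elements) |𝔽q|≡q)) (sym |Z|≡q²) q<q*q

  ∃-nonzero-trace-zero : Σ Carrier λ e → Tr e ≡ 0# × e ≢ 0#
  ∃-nonzero-trace-zero =
    let e , e∈Z , e∉[0] = ∃-∉ _≟_ {trace-zeros} {0# ∷ []} (members-unique Tr≡0?) 1<|Z|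
    in e , ∈-members⁻ Tr≡0? e∈Z , λ e≡0 → e∉[0] (here e≡0)

  record TraceZeroBasis : Set where
    field
      e₁ e₂   : Carrier
      Tr-e₁≡0 : Tr e₁ ≡ 0#
      Tr-e₂≡0 : Tr e₂ ≡ 0#
      e₁∧e₂≢0 : e₁ ∧ e₂ ≢ 0#

  traceZeroBasis : TraceZeroBasis
  traceZeroBasis =
    let e₁ , Tr-e₁≡0 , e₁≢0 = ∃-nonzero-trace-zero
        e₂ , e₂∈Z , e₂∉𝔽q·e₁ = ∃-∉ _≟_ {trace-zeros} {map (_* e₁) 𝔽q-elements} (members-unique Tr≡0?) (|𝔽q·x|<|Z| e₁)
    in record
      { e₁ = e₁ ; e₂ = e₂ ; Tr-e₁≡0 = Tr-e₁≡0 ; Tr-e₂≡0 = ∈-members⁻ Tr≡0? e₂∈Z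
      ; e₁∧e₂≢0 = λ e₁∧e₂≡0 → e₂∉𝔽q·e₁ (subst (_∈ map (_* e₁) 𝔽q-elements) (y*x⁻¹*x≡y e₁≢0 e₂)
                    (∈-map⁺ (_* e₁) (∈-members⁺ 𝔽q? (∧≡0⇒𝔽q-ratio e₁≢0 e₁∧e₂≡0))))
      }

  module Directions (basis : TraceZeroBasis) where

    open TraceZeroBasis basis

    w : Carrier
    w = e₁ ∧ e₂

    w≢0 : w ≢ 0#
    w≢0 = e₁∧e₂≢0

    t : Fin (length 𝔽q-elements) → Carrier
    t = lookup 𝔽q-elements

    𝔽q-t : ∀ j → 𝔽q (t j)
    𝔽q-t j = ∈-members⁻ 𝔽q? (∈-lookup j)

    -- e₁ and the e₂ + t e₁ (t ∈ 𝔽q) represent the q + 1 points of the projective line P(Z) over 𝔽q.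
    direction : Fin (suc (length 𝔽q-elements)) → Carrier
    direction Fin.zero    = e₁
    direction (Fin.suc j) = e₂ + t j * e₁

    e₁∧direction-suc : ∀ j → e₁ ∧ direction (Fin.suc j) ≡ w
    e₁∧direction-suc j = begin
      e₁ ∧ (e₂ + t j * e₁)          ≡⟨ ∧-+ʳ e₁ e₂ (t j * e₁) ⟩
      w + e₁ ∧ (t j * e₁)           ≡⟨ cong (w +_) (∧-𝔽q-*ʳ e₁ e₁ (𝔽q-t j)) ⟩
      w + t j * (e₁ ∧ e₁)           ≡⟨ cong (λ u → w + t j * u) (∧-self e₁) ⟩
      w + t j * 0#                  ≡⟨ trans (cong (w +_) (zeroʳ (t j))) (+-identityʳ w) ⟩
      w                             ∎

    direction-suc∧e₂ : ∀ j → direction (Fin.suc j) ∧ e₂ ≡ t j * w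
    direction-suc∧e₂ j = begin
      (e₂ + t j * e₁) ∧ e₂          ≡⟨ ∧-+ˡ e₂ (t j * e₁) e₂ ⟩
      e₂ ∧ e₂ + (t j * e₁) ∧ e₂     ≡⟨ cong₂ _+_ (∧-self e₂) (∧-𝔽q-*ˡ e₁ e₂ (𝔽q-t j)) ⟩
      0# + t j * w                  ≡⟨ +-identityˡ _ ⟩
      t j * w                       ∎

    direction-trace-zero : ∀ i → Tr (direction i) ≡ 0#
    direction-trace-zero Fin.zero    = Tr-e₁≡0
    direction-trace-zero (Fin.suc j) = begin
      Tr (e₂ + t j * e₁)            ≡⟨ Tr-+ e₂ (t j * e₁) ⟩
      Tr e₂ + Tr (t j * e₁)         ≡⟨ cong₂ _+_ Tr-e₂≡0 (Tr-𝔽q-* e₁ (𝔽q-t j)) ⟩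
      0# + t j * Tr e₁              ≡⟨ cong (λ u → 0# + t j * u) Tr-e₁≡0 ⟩
      0# + t j * 0#                 ≡⟨ trans (+-identityˡ _) (zeroʳ (t j)) ⟩
      0#                            ∎

    direction-≢0 : ∀ i → direction i ≢ 0#
    direction-≢0 Fin.zero    e₁≡0 = w≢0 (trans (cong (_∧ e₂) e₁≡0) (0∧x≡0 e₂))
    direction-≢0 (Fin.suc j) d≡0  = w≢0 (begin
      w                             ≡⟨ e₁∧direction-suc j ⟨
      e₁ ∧ direction (Fin.suc j)    ≡⟨ cong (e₁ ∧_) d≡0 ⟩
      e₁ ∧ 0#                       ≡⟨ cong (e₁ ∧_) (zeroˡ 0#) ⟨
      e₁ ∧ (0# * 0#)                ≡⟨ ∧-𝔽q-*ʳ e₁ 0# φ-0 ⟩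
      0# * (e₁ ∧ 0#)                ≡⟨ zeroˡ _ ⟩
      0#                            ∎)

    private
      e₁∧-resp : ∀ i j {c} → 𝔽q c → direction i ≡ c * direction j → e₁ ∧ direction i ≡ c * (e₁ ∧ direction j)
      e₁∧-resp i j 𝔽q-c e = trans (cong (e₁ ∧_) e) (∧-𝔽q-*ʳ e₁ (direction j) 𝔽q-c)

      ∧e₂-resp : ∀ i j {c} → 𝔽q c → direction i ≡ c * direction j → direction i ∧ e₂ ≡ c * (direction j ∧ e₂)
      ∧e₂-resp i j 𝔽q-c e = trans (cong (_∧ e₂) e) (∧-𝔽q-*ˡ (direction j) e₂ 𝔽q-c)

      e₁≡c*direction-suc⇒c≡0 : ∀ j {c} → 𝔽q c → e₁ ≡ c * direction (Fin.suc j) → c ≡ 0#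
      e₁≡c*direction-suc⇒c≡0 j {c} 𝔽q-c e = x*y≡0⇒y≡0 w≢0 (begin
        w * c                              ≡⟨ *-comm w c ⟩
        c * w                              ≡⟨ cong (c *_) (e₁∧direction-suc j) ⟨
        c * (e₁ ∧ direction (Fin.suc j))   ≡⟨ e₁∧-resp Fin.zero (Fin.suc j) 𝔽q-c e ⟨
        e₁ ∧ e₁                            ≡⟨ ∧-self e₁ ⟩
        0#                                 ∎)

      direction-suc≡c*direction-suc⇒c≡1 : ∀ i j {c} → 𝔽q c → direction (Fin.suc i) ≡ c * direction (Fin.suc j) → c ≡ 1#
      direction-suc≡c*direction-suc⇒c≡1 i j {c} 𝔽q-c e = *-cancelˡ w≢0 (begin
        w * c                              ≡⟨ *-comm w c ⟩
        c * w                              ≡⟨ cong (c *_) (e₁∧direction-suc j) ⟨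
        c * (e₁ ∧ direction (Fin.suc j))   ≡⟨ e₁∧-resp (Fin.suc i) (Fin.suc j) 𝔽q-c e ⟨
        e₁ ∧ direction (Fin.suc i)         ≡⟨ e₁∧direction-suc i ⟩
        w                                  ≡⟨ *-identityʳ w ⟨
        w * 1#                             ∎)

    direction-injective : ∀ i j {c} → 𝔽q c → direction i ≡ c * direction j → i ≡ j
    direction-injective Fin.zero    Fin.zero    _    _ = refl
    direction-injective Fin.zero    (Fin.suc j) 𝔽q-c e =
      ⊥-elim (direction-≢0 Fin.zero (trans e (trans (cong (_* _) (e₁≡c*direction-suc⇒c≡0 j 𝔽q-c e)) (zeroˡ _))))
    direction-injective (Fin.suc i) Fin.zero    {c} 𝔽q-c e = ⊥-elim (w≢0 (begin
      w                                    ≡⟨ e₁∧direction-suc i ⟨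
      e₁ ∧ direction (Fin.suc i)           ≡⟨ e₁∧-resp (Fin.suc i) Fin.zero 𝔽q-c e ⟩
      c * (e₁ ∧ e₁)                        ≡⟨ cong (c *_) (∧-self e₁) ⟩
      c * 0#                               ≡⟨ zeroʳ c ⟩
      0#                                   ∎))
    direction-injective (Fin.suc i) (Fin.suc j) {c} 𝔽q-c e =
      cong Fin.suc (lookup-injective (members-unique 𝔽q?) i j (*-cancelˡ w≢0 (begin
        w * t i                            ≡⟨ *-comm w (t i) ⟩
        t i * w                            ≡⟨ direction-suc∧e₂ i ⟨
        direction (Fin.suc i) ∧ e₂         ≡⟨ ∧e₂-resp (Fin.suc i) (Fin.suc j) 𝔽q-c e ⟩
        c * (direction (Fin.suc j) ∧ e₂)   ≡⟨ cong₂ _*_ (direction-suc≡c*direction-suc⇒c≡1 i j 𝔽q-c e) (direction-suc∧e₂ j) ⟩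
        1# * (t j * w)                     ≡⟨ trans (*-identityˡ _) (*-comm (t j) w) ⟩
        w * t j                            ∎)))

    𝔽q-w : 𝔽q w
    𝔽q-w = ∧-trace-zero Tr-e₁≡0 Tr-e₂≡0

    direction-complete : ∀ {s} → Tr s ≡ 0# → ∃ λ i → ∃ λ c → 𝔽q c × s ≡ c * direction i
    direction-complete {s} Tr-s≡0 with e₁ ∧ s ≟ 0#
    ... | yes b≡0 = Fin.zero , a * w≢0 ⁻¹ , 𝔽q-* 𝔽q-a (𝔽q-⁻¹ w≢0 𝔽q-w) , (begin
      s                                    ≡⟨ s≡ ⟩
      w≢0 ⁻¹ * (a * e₁ + (e₁ ∧ s) * e₂)    ≡⟨ cong (λ b → w≢0 ⁻¹ * (a * e₁ + b * e₂)) b≡0 ⟩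
      w≢0 ⁻¹ * (a * e₁ + 0# * e₂)
        ≡⟨ solve 4 (λ i a e₁ e₂ → i :* (a :* e₁ :+ 0ᶜ :* e₂) := a :* i :* e₁) refl (w≢0 ⁻¹) a e₁ e₂ ⟩
      a * w≢0 ⁻¹ * e₁                      ∎)
      where
      a : Carrier
      a = s ∧ e₂
      𝔽q-a : 𝔽q a
      𝔽q-a = ∧-trace-zero Tr-s≡0 Tr-e₂≡0
      s≡ : s ≡ w≢0 ⁻¹ * (a * e₁ + (e₁ ∧ s) * e₂)
      s≡ = trans (sym (x⁻¹*[x*y]≡y w≢0 s)) (cong (w≢0 ⁻¹ *_) (cramer e₁ e₂ s))
    ... | no  b≢0 = Fin.suc j , b * w≢0 ⁻¹ , 𝔽q-* 𝔽q-b (𝔽q-⁻¹ w≢0 𝔽q-w) , (begin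
      s                                    ≡⟨ s≡ ⟩
      w≢0 ⁻¹ * (a * e₁ + b * e₂)           ≡⟨ cong (λ u → w≢0 ⁻¹ * (u * e₁ + b * e₂)) (y*x⁻¹*x≡y b≢0 a) ⟨
      w≢0 ⁻¹ * (a * b≢0 ⁻¹ * b * e₁ + b * e₂)
        ≡⟨ solve 5 (λ i a′ b e₁ e₂ → i :* (a′ :* b :* e₁ :+ b :* e₂) := b :* i :* (e₂ :+ a′ :* e₁)) refl (w≢0 ⁻¹) (a * b≢0 ⁻¹) b e₁ e₂ ⟩
      b * w≢0 ⁻¹ * (e₂ + a * b≢0 ⁻¹ * e₁)  ≡⟨ cong (λ u → b * w≢0 ⁻¹ * (e₂ + u * e₁)) a*b⁻¹≡t-j ⟩
      b * w≢0 ⁻¹ * direction (Fin.suc j)   ∎)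
      where
      a b : Carrier
      a = s ∧ e₂
      b = e₁ ∧ s
      𝔽q-b : 𝔽q b
      𝔽q-b = ∧-trace-zero Tr-e₁≡0 Tr-s≡0
      a/b∈𝔽q : a * b≢0 ⁻¹ ∈ 𝔽q-elements
      a/b∈𝔽q = ∈-members⁺ 𝔽q? (𝔽q-* (∧-trace-zero Tr-s≡0 Tr-e₂≡0) (𝔽q-⁻¹ b≢0 𝔽q-b))
      j : Fin (length 𝔽q-elements)
      j = index a/b∈𝔽q
      a*b⁻¹≡t-j : a * b≢0 ⁻¹ ≡ t j
      a*b⁻¹≡t-j = lookup-index a/b∈𝔽q
      s≡ : s ≡ w≢0 ⁻¹ * (a * e₁ + b * e₂)
      s≡ = trans (sym (x⁻¹*[x*y]≡y w≢0 s)) (cong (w≢0 ⁻¹ *_) (cramer e₁ e₂ s))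

module ProjectivePlane (F : FiniteField) where

  open FiniteField F
  open FiniteFieldTheory F
  -- These notions of PG F q do not depend on q.
  open PG F 0 using (Triple; zero3; NonZero3; scale; _∼_; Incident; cross; join; meet; T; mT)
  open ≡-Reasoning

  scale-1 : ∀ P → scale 1# P ≡ P
  scale-1 (x , y , z) = cong₂ _,_ (*-identityˡ x) (cong₂ _,_ (*-identityˡ y) (*-identityˡ z))

  scale-* : ∀ l m P → scale l (scale m P) ≡ scale (l * m) P
  scale-* l m (x , y , z) = sym (cong₂ _,_ (*-assoc l m x) (cong₂ _,_ (*-assoc l m y) (*-assoc l m z)))

  ∼-refl : ∀ {P} → P ∼ P
  ∼-refl {P} = 1# , 1≢0 , sym (scale-1 P)

  ∼-trans : ∀ {P Q R} → P ∼ Q → Q ∼ R → P ∼ R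
  ∼-trans {R = R} (l , l≢0 , P≡lQ) (m , m≢0 , Q≡mR) = l * m , *-≢0 l≢0 m≢0 , trans P≡lQ (trans (cong (scale l) Q≡mR) (scale-* l m R))

  ∼-sym : ∀ {P Q} → P ∼ Q → Q ∼ P
  ∼-sym {P} {Q} (l , l≢0 , P≡lQ) = l≢0 ⁻¹ , ⁻¹-≢0 l≢0 , (begin
    Q                          ≡⟨ scale-1 Q ⟨
    scale 1# Q                 ≡⟨ cong (λ u → scale u Q) (x⁻¹*x≡1 l≢0) ⟨
    scale (l≢0 ⁻¹ * l) Q       ≡⟨ scale-* (l≢0 ⁻¹) l Q ⟨
    scale (l≢0 ⁻¹) (scale l Q) ≡⟨ cong (scale (l≢0 ⁻¹)) P≡lQ ⟨
    scale (l≢0 ⁻¹) P           ∎)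

  scale-∼ : ∀ {l} P → l ≢ 0# → scale l P ∼ P
  scale-∼ P l≢0 = _ , l≢0 , refl

  dot : Triple → Triple → Carrier
  dot (a , b , c) (x , y , z) = a * x + b * y + c * z

  dot-scaleʳ : ∀ ℓ l P → dot ℓ (scale l P) ≡ l * dot ℓ P
  dot-scaleʳ (a , b , c) l (x , y , z) =
    solve 7 (λ a b c l x y z → a :* (l :* x) :+ b :* (l :* y) :+ c :* (l :* z) := l :* (a :* x :+ b :* y :+ c :* z)) refl a b c l x y z

  Incident-∼ : ∀ {ℓ P Q} → P ∼ Q → Incident ℓ P → Incident ℓ Q
  Incident-∼ {ℓ} {P} {Q} (l , l≢0 , P≡lQ) ℓ·P≡0 = x*y≡0⇒y≡0 l≢0 (begin
    l * dot ℓ Q          ≡⟨ dot-scaleʳ ℓ l Q ⟨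
    dot ℓ (scale l Q)    ≡⟨ cong (dot ℓ) P≡lQ ⟨
    dot ℓ P              ≡⟨ ℓ·P≡0 ⟩
    0#                   ∎)

  cross-scaleˡ : ∀ l A B → cross (scale l A) B ≡ scale l (cross A B)
  cross-scaleˡ l (a , b , c) (x , y , z) = cong₂ _,_
    (solve 5 (λ l b c y z → (l :* b) :* z :- (l :* c) :* y := l :* (b :* z :- c :* y)) refl l b c y z)
    (cong₂ _,_
      (solve 5 (λ l a c x z → (l :* c) :* x :- (l :* a) :* z := l :* (c :* x :- a :* z)) refl l a c x z)
      (solve 5 (λ l a b x y → (l :* a) :* y :- (l :* b) :* x := l :* (a :* y :- b :* x)) refl l a b x y))

  cross-scaleʳ : ∀ l A B → cross A (scale l B) ≡ scale l (cross A B)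
  cross-scaleʳ l (a , b , c) (x , y , z) = cong₂ _,_
    (solve 5 (λ l b c y z → b :* (l :* z) :- c :* (l :* y) := l :* (b :* z :- c :* y)) refl l b c y z)
    (cong₂ _,_
      (solve 5 (λ l a c x z → c :* (l :* x) :- a :* (l :* z) := l :* (c :* x :- a :* z)) refl l a c x z)
      (solve 5 (λ l a b x y → a :* (l :* y) :- b :* (l :* x) := l :* (a :* y :- b :* x)) refl l a b x y))

  cross-∼ˡ : ∀ {A A′} B → A ∼ A′ → cross A B ∼ cross A′ B
  cross-∼ˡ {A′ = A′} B (l , l≢0 , A≡lA′) = l , l≢0 , trans (cong (λ X → cross X B) A≡lA′) (cross-scaleˡ l A′ B)

  cross-∼ʳ : ∀ A {B B′} → B ∼ B′ → cross A B ∼ cross A B′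
  cross-∼ʳ A {B′ = B′} (l , l≢0 , B≡lB′) = l , l≢0 , trans (cong (cross A) B≡lB′) (cross-scaleʳ l A B′)

  scale⇒∼ : ∀ {A C l} → NonZero3 A → A ≡ scale l C → A ∼ C
  scale⇒∼ {C = c₁ , c₂ , c₃} {l} A≢0 A≡lC = l , l≢0 , A≡lC
    where
    l≢0 : l ≢ 0#
    l≢0 l≡0 = A≢0 (trans A≡lC (cong₂ _,_ (l*≡0 c₁) (cong₂ _,_ (l*≡0 c₂) (l*≡0 c₃))))
      where
      l*≡0 : ∀ c → l * c ≡ 0#
      l*≡0 c = trans (cong (_* c) l≡0) (zeroˡ c)

  cross≡0⇒∼ : ∀ {A C} → NonZero3 A → NonZero3 C → cross A C ≡ zero3 → A ∼ C
  cross≡0⇒∼ {A@(a₁ , a₂ , a₃)} {C@(c₁ , c₂ , c₃)} A≢0 C≢0 A×C≡0 = by-cases (c₁ ≟ 0#) (c₂ ≟ 0#) (c₃ ≟ 0#)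
    where
    r₁ : a₂ * c₃ ≡ a₃ * c₂
    r₁ = x∙y⁻¹≈ε⇒x≈y _ _ (cong proj₁ A×C≡0)
    r₂ : a₃ * c₁ ≡ a₁ * c₃
    r₂ = x∙y⁻¹≈ε⇒x≈y _ _ (cong (proj₁ ∘ proj₂) A×C≡0)
    r₃ : a₁ * c₂ ≡ a₂ * c₁
    r₃ = x∙y⁻¹≈ε⇒x≈y _ _ (cong (proj₂ ∘ proj₂) A×C≡0)
    by-cases : Dec (c₁ ≡ 0#) → Dec (c₂ ≡ 0#) → Dec (c₃ ≡ 0#) → A ∼ C
    by-cases (no c₁≢0) _ _ = scale⇒∼ A≢0
      (cong₂ _,_ (sym (y*x⁻¹*x≡y c₁≢0 a₁)) (cong₂ _,_ (ad≡bc⇒b≡a*c⁻¹*d c₁≢0 r₃) (ad≡bc⇒b≡a*c⁻¹*d c₁≢0 (sym r₂))))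
    by-cases (yes _) (no c₂≢0) _ = scale⇒∼ A≢0
      (cong₂ _,_ (ad≡bc⇒b≡a*c⁻¹*d c₂≢0 (sym r₃)) (cong₂ _,_ (sym (y*x⁻¹*x≡y c₂≢0 a₂)) (ad≡bc⇒b≡a*c⁻¹*d c₂≢0 r₁)))
    by-cases (yes _) (yes _) (no c₃≢0) = scale⇒∼ A≢0
      (cong₂ _,_ (ad≡bc⇒b≡a*c⁻¹*d c₃≢0 r₂) (cong₂ _,_ (ad≡bc⇒b≡a*c⁻¹*d c₃≢0 (sym r₁)) (sym (y*x⁻¹*x≡y c₃≢0 a₃))))
    by-cases (yes c₁≡0) (yes c₂≡0) (yes c₃≡0) = ⊥-elim (C≢0 (cong₂ _,_ c₁≡0 (cong₂ _,_ c₂≡0 c₃≡0)))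

  -- ℓ × (P × Q) = ⟨ℓ,Q⟩ P - ⟨ℓ,P⟩ Q vanishes, so ℓ is proportional to P × Q.
  line-through : ∀ {ℓ P Q} → NonZero3 ℓ → Incident ℓ P → Incident ℓ Q → NonZero3 (cross P Q) → ℓ ∼ cross P Q
  line-through {ℓ@(a , b , c)} {P@(x₁ , y₁ , z₁)} {Q@(x₂ , y₂ , z₂)} ℓ≢0 ℓ·P≡0 ℓ·Q≡0 P×Q≢0 =
    cross≡0⇒∼ ℓ≢0 P×Q≢0 (cong₂ _,_ (trans first (component x₁ x₂))
                          (cong₂ _,_ (trans second (component y₁ y₂)) (trans third (component z₁ z₂))))
    where
    first : b * (x₁ * y₂ - y₁ * x₂) - c * (z₁ * x₂ - x₁ * z₂) ≡ dot ℓ Q * x₁ - dot ℓ P * x₂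
    first = solve 9 (λ a b c x₁ y₁ z₁ x₂ y₂ z₂ →
      b :* (x₁ :* y₂ :- y₁ :* x₂) :- c :* (z₁ :* x₂ :- x₁ :* z₂) :=
      (a :* x₂ :+ b :* y₂ :+ c :* z₂) :* x₁ :- (a :* x₁ :+ b :* y₁ :+ c :* z₁) :* x₂) refl a b c x₁ y₁ z₁ x₂ y₂ z₂
    second : c * (y₁ * z₂ - z₁ * y₂) - a * (x₁ * y₂ - y₁ * x₂) ≡ dot ℓ Q * y₁ - dot ℓ P * y₂
    second = solve 9 (λ a b c x₁ y₁ z₁ x₂ y₂ z₂ →
      c :* (y₁ :* z₂ :- z₁ :* y₂) :- a :* (x₁ :* y₂ :- y₁ :* x₂) :=
      (a :* x₂ :+ b :* y₂ :+ c :* z₂) :* y₁ :- (a :* x₁ :+ b :* y₁ :+ c :* z₁) :* y₂) refl a b c x₁ y₁ z₁ x₂ y₂ z₂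
    third : a * (z₁ * x₂ - x₁ * z₂) - b * (y₁ * z₂ - z₁ * y₂) ≡ dot ℓ Q * z₁ - dot ℓ P * z₂
    third = solve 9 (λ a b c x₁ y₁ z₁ x₂ y₂ z₂ →
      a :* (z₁ :* x₂ :- x₁ :* z₂) :- b :* (y₁ :* z₂ :- z₁ :* y₂) :=
      (a :* x₂ :+ b :* y₂ :+ c :* z₂) :* z₁ :- (a :* x₁ :+ b :* y₁ :+ c :* z₁) :* z₂) refl a b c x₁ y₁ z₁ x₂ y₂ z₂
    component : ∀ u v → dot ℓ Q * u - dot ℓ P * v ≡ 0#
    component u v = begin
      dot ℓ Q * u - dot ℓ P * v    ≡⟨ cong₂ (λ s t → s * u - t * v) ℓ·Q≡0 ℓ·P≡0 ⟩
      0# * u - 0# * v              ≡⟨ solve 2 (λ u v → 0ᶜ :* u :- 0ᶜ :* v := 0ᶜ) refl u v ⟩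
      0#                           ∎

  projection-from-T : ∀ x y z → meet (join T (x , y , z)) mT ≡ (x , y , 0#)
  projection-from-T x y z = cong₂ _,_
    (solve 3 (λ x y z → (1ᶜ :* x :- 0ᶜ :* z) :* 1ᶜ :- (0ᶜ :* y :- 0ᶜ :* x) :* 0ᶜ := x) refl x y z)
    (cong₂ _,_
      (solve 3 (λ x y z → (0ᶜ :* y :- 0ᶜ :* x) :* 0ᶜ :- (0ᶜ :* z :- 1ᶜ :* y) :* 1ᶜ := y) refl x y z)
      (solve 3 (λ x y z → (0ᶜ :* z :- 1ᶜ :* y) :* 0ᶜ :- (1ᶜ :* x :- 0ᶜ :* z) :* 0ᶜ := 0ᶜ) refl x y z))

module Subplane (F : FiniteField) (p k : ℕ) (p-prime : Prime p)
  (|F|≡q³ : length (FiniteField.elems F) ≡ (p ℕ.^ suc k) ℕ.^ 3)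
  (θ : FiniteField.Carrier F) (θ≢0 : θ ≢ FiniteField.0# F) where

  open FiniteField F
  open FiniteFieldTheory F
  open CubicExtension F p k p-prime |F|≡q³
  open ProjectivePlane F
  open PG F q using (Triple; NonZero3; scale; _∼_; Incident; cross; meet; join; T; mT; S; Π; IsLineOf; Pr; Sp)
    renaming (_^_ to _^ᴾ_)
  open Directions traceZeroBasis
    using (direction; direction-trace-zero; direction-≢0; direction-injective; direction-complete)
  open ≡-Reasoning

  N : Carrier
  N = φ θ * θ

  N≢0 : N ≢ 0#
  N≢0 = *-≢0 (φ-≢0 θ≢0) θ≢0

  π : Carrier → Triple
  π r = (r * N , φ r , φ (φ r) * θ)

  line : Carrier → Triple
  line u = (u , φ u * N , φ (φ u) * φ θ)

  ^ᴾ≡^ : ∀ x n → x ^ᴾ n ≡ x ^ n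
  ^ᴾ≡^ x zero    = refl
  ^ᴾ≡^ x (suc n) = cong (x *_) (^ᴾ≡^ x n)

  Π-coordinates : ∀ r → (r * θ ^ᴾ (q ℕ.+ 1) , r ^ᴾ q , r ^ᴾ (q ℕ.* q) * θ) ≡ π r
  Π-coordinates r = cong₂ _,_ (cong (r *_) θ^[q+1]≡N) (cong₂ _,_ (^ᴾ≡^ r q) (cong (_* θ) r^[q*q]≡φφr))
    where
    θ^[q+1]≡N : θ ^ᴾ (q ℕ.+ 1) ≡ N
    θ^[q+1]≡N = trans (^ᴾ≡^ θ (q ℕ.+ 1)) (trans (^-homo-* θ q 1) (cong (φ θ *_) (*-identityʳ θ)))
    r^[q*q]≡φφr : r ^ᴾ (q ℕ.* q) ≡ φ (φ r)
    r^[q*q]≡φφr = trans (^ᴾ≡^ r (q ℕ.* q)) (sym (^-assocʳ r q q))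

  S-coordinates : ∀ c x → (x * c , x ^ᴾ q , 0#) ≡ (x * c , φ x , 0#)
  S-coordinates c x = cong (λ y → x * c , y , 0#) (^ᴾ≡^ x q)

  Π⁻ : ∀ {P} → Π θ P → ∃ λ r → r ≢ 0# × P ∼ π r
  Π⁻ (r , r≢0 , P∼) = r , r≢0 , subst (_ ∼_) (Π-coordinates r) P∼

  π∈Π : ∀ {r} → r ≢ 0# → Π θ (π r)
  π∈Π {r} r≢0 = r , r≢0 , subst (π r ∼_) (sym (Π-coordinates r)) ∼-refl

  S⁻ : ∀ {c P} → S c P → ∃ λ x → x ≢ 0# × P ∼ (x * c , φ x , 0#)
  S⁻ {c} (x , x≢0 , P∼) = x , x≢0 , subst (_ ∼_) (S-coordinates c x) P∼

  S⁺ : ∀ {c P x} → x ≢ 0# → P ∼ (x * c , φ x , 0#) → S c P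
  S⁺ {c} {x = x} x≢0 P∼ = x , x≢0 , subst (_ ∼_) (sym (S-coordinates c x)) P∼

  dot-line-π : ∀ u r → dot (line u) (π r) ≡ N * Tr (u * r)
  dot-line-π u r = begin
    u * (r * N) + (φ u * N) * φ r + (φ (φ u) * φ θ) * (φ (φ r) * θ)
      ≡⟨ solve 8 (λ u r a b c d t s → u :* (r :* (s :* t)) :+ (a :* (s :* t)) :* b :+ (c :* s) :* (d :* t) := (s :* t) :* (u :* r :+ a :* b :+ c :* d))
           refl u r (φ u) (φ r) (φ (φ u)) (φ (φ r)) θ (φ θ) ⟩
    N * (u * r + φ u * φ r + φ (φ u) * φ (φ r))
      ≡⟨ cong₂ (λ s t → N * (u * r + s + t)) (φ-* u r) (trans (cong φ (φ-* u r)) (φ-* (φ u) (φ r))) ⟨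
    N * Tr (u * r) ∎

  π-𝔽q-* : ∀ {c} r → 𝔽q c → π (c * r) ≡ scale c (π r)
  π-𝔽q-* {c} r φc≡c = cong₂ _,_ (*-assoc c r N) (cong₂ _,_ (φ-𝔽q-* r φc≡c) (begin
    φ (φ (c * r)) * θ         ≡⟨ cong (λ x → φ x * θ) (φ-𝔽q-* r φc≡c) ⟩
    φ (c * φ r) * θ           ≡⟨ cong (_* θ) (φ-𝔽q-* (φ r) φc≡c) ⟩
    c * φ (φ r) * θ           ≡⟨ *-assoc c _ θ ⟩
    c * (φ (φ r) * θ)         ∎))

  π≡scale⇒𝔽q : ∀ {r r′ l} → r′ ≢ 0# → π r ≡ scale l (π r′) → r ≡ l * r′ × 𝔽q l
  π≡scale⇒𝔽q {r} {r′} {l} r′≢0 πr≡lπr′ = r≡lr′ , 𝔽q-l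
    where
    r≡lr′ : r ≡ l * r′
    r≡lr′ = *-cancelˡ N≢0 (begin
      N * r           ≡⟨ *-comm N r ⟩
      r * N           ≡⟨ cong proj₁ πr≡lπr′ ⟩
      l * (r′ * N)    ≡⟨ solve 3 (λ l r′ n → l :* (r′ :* n) := n :* (l :* r′)) refl l r′ N ⟩
      N * (l * r′)    ∎)
    𝔽q-l : 𝔽q l
    𝔽q-l = *-cancelˡ (φ-≢0 r′≢0) (begin
      φ r′ * φ l      ≡⟨ *-comm (φ r′) (φ l) ⟩
      φ l * φ r′      ≡⟨ φ-* l r′ ⟨
      φ (l * r′)      ≡⟨ cong φ r≡lr′ ⟨
      φ r             ≡⟨ cong (proj₁ ∘ proj₂) πr≡lπr′ ⟩
      l * φ r′        ≡⟨ *-comm l (φ r′) ⟩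
      φ r′ * l        ∎)

  cross-π : ∀ r₀ r₁ → cross (π r₀) (π r₁) ≡ scale θ (line (φ (r₀ ∧ r₁)))
  cross-π r₀ r₁ = cong₂ _,_ first (cong₂ _,_ second third)
    where
    w : Carrier
    w = r₀ ∧ r₁
    φφw : φ (φ w) ≡ φ (φ r₀) * r₁ - r₀ * φ (φ r₁)
    φφw = begin
      φ (φ w)                                              ≡⟨ trans (cong φ (φ-∧ r₀ r₁)) (φ-∧ (φ r₀) (φ r₁)) ⟩
      φ (φ r₀) * φ (φ (φ r₁)) - φ (φ (φ r₀)) * φ (φ r₁)    ≡⟨ cong₂ (λ a b → φ (φ r₀) * a - b * φ (φ r₁)) (φ³≡id r₁) (φ³≡id r₀) ⟩
      φ (φ r₀) * r₁ - r₀ * φ (φ r₁)                        ∎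
    first : φ r₀ * (φ (φ r₁) * θ) - (φ (φ r₀) * θ) * φ r₁ ≡ θ * φ w
    first = begin
      φ r₀ * (φ (φ r₁) * θ) - (φ (φ r₀) * θ) * φ r₁
        ≡⟨ solve 5 (λ a₀ a₁ b₀ b₁ t → a₀ :* (b₁ :* t) :- (b₀ :* t) :* a₁ := t :* (a₀ :* b₁ :- b₀ :* a₁)) refl (φ r₀) (φ r₁) (φ (φ r₀)) (φ (φ r₁)) θ ⟩
      θ * (φ r₀ ∧ φ r₁)                                    ≡⟨ cong (θ *_) (φ-∧ r₀ r₁) ⟨
      θ * φ w                                              ∎
    second : (φ (φ r₀) * θ) * (r₁ * N) - (r₀ * N) * (φ (φ r₁) * θ) ≡ θ * (φ (φ w) * N)
    second = begin
      (φ (φ r₀) * θ) * (r₁ * N) - (r₀ * N) * (φ (φ r₁) * θ)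
        ≡⟨ solve 6 (λ b₀ b₁ r₀ r₁ t n → (b₀ :* t) :* (r₁ :* n) :- (r₀ :* n) :* (b₁ :* t) := t :* ((b₀ :* r₁ :- r₀ :* b₁) :* n))
             refl (φ (φ r₀)) (φ (φ r₁)) r₀ r₁ θ N ⟩
      θ * ((φ (φ r₀) * r₁ - r₀ * φ (φ r₁)) * N)            ≡⟨ cong (λ x → θ * (x * N)) φφw ⟨
      θ * (φ (φ w) * N)                                    ∎
    third : (r₀ * N) * φ r₁ - φ r₀ * (r₁ * N) ≡ θ * (φ (φ (φ w)) * φ θ)
    third = begin
      (r₀ * N) * φ r₁ - φ r₀ * (r₁ * N)
        ≡⟨ solve 6 (λ r₀ r₁ a₀ a₁ t s → (r₀ :* (s :* t)) :* a₁ :- a₀ :* (r₁ :* (s :* t)) := t :* ((r₀ :* a₁ :- a₀ :* r₁) :* s))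
             refl r₀ r₁ (φ r₀) (φ r₁) θ (φ θ) ⟩
      θ * (w * φ θ)                                        ≡⟨ cong (λ x → θ * (x * φ θ)) (φ³≡id w) ⟨
      θ * (φ (φ (φ w)) * φ θ)                              ∎

  meet-line : ∀ {u x} → θ * x * u ≡ 1# → (x * - (θ * θ) , φ x , 0#) ∼ meet (line u) mT
  meet-line {u} {x} θxu≡1 = l , l≢0 , cong₂ _,_ first (cong₂ _,_ second third)
    where
    x≢0 : x ≢ 0#
    x≢0 x≡0 = 1≢0 (trans (sym θxu≡1) (trans (cong (λ y → θ * y * u) x≡0) (solve 2 (λ t u → t :* 0ᶜ :* u := 0ᶜ) refl θ u)))
    l : Carrier
    l = - (φ x * (θ * x))
    l≢0 : l ≢ 0#
    l≢0 = -‿≢0 (*-≢0 (φ-≢0 x≢0) (*-≢0 θ≢0 x≢0))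
    φθφxφu≡1 : φ θ * φ x * φ u ≡ 1#
    φθφxφu≡1 = trans (sym (trans (φ-* (θ * x) u) (cong (_* φ u) (φ-* θ x)))) (trans (cong φ θxu≡1) φ-1)
    first : x * - (θ * θ) ≡ l * ((φ u * N) * 1# - (φ (φ u) * φ θ) * 0#)
    first = sym (begin
      l * ((φ u * N) * 1# - (φ (φ u) * φ θ) * 0#)
        ≡⟨ solve 6 (λ a t x b s c → :- (a :* (t :* x)) :* ((b :* (s :* t)) :* 1ᶜ :- (c :* s) :* 0ᶜ) := (x :* :- (t :* t)) :* (s :* a :* b))
             refl (φ x) θ x (φ u) (φ θ) (φ (φ u)) ⟩
      (x * - (θ * θ)) * (φ θ * φ x * φ u)      ≡⟨ cong ((x * - (θ * θ)) *_) φθφxφu≡1 ⟩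
      (x * - (θ * θ)) * 1#                     ≡⟨ *-identityʳ _ ⟩
      x * - (θ * θ)                            ∎)
    second : φ x ≡ l * ((φ (φ u) * φ θ) * 0# - u * 1#)
    second = sym (begin
      l * ((φ (φ u) * φ θ) * 0# - u * 1#)
        ≡⟨ solve 5 (λ a t x c u → :- (a :* (t :* x)) :* (c :* 0ᶜ :- u :* 1ᶜ) := a :* (t :* x :* u)) refl (φ x) θ x (φ (φ u) * φ θ) u ⟩
      φ x * (θ * x * u)                        ≡⟨ cong (φ x *_) θxu≡1 ⟩
      φ x * 1#                                 ≡⟨ *-identityʳ _ ⟩
      φ x                                      ∎)
    third : 0# ≡ l * (u * 0# - (φ u * N) * 0#)
    third = sym (solve 3 (λ l u b → l :* (u :* 0ᶜ :- b :* 0ᶜ) := 0ᶜ) refl l u (φ u * N))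

  projection-π : ∀ x → meet (join T (π (x * θ))) mT ∼ (x * (θ * θ) , φ x , 0#)
  projection-π x = φ θ , φ-≢0 θ≢0 , trans (projection-from-T _ _ _) (cong₂ _,_ first (cong₂ _,_ second (sym (zeroʳ (φ θ)))))
    where
    first : x * θ * N ≡ φ θ * (x * (θ * θ))
    first = solve 3 (λ x t s → x :* t :* (s :* t) := s :* (x :* (t :* t))) refl x θ (φ θ)
    second : φ (x * θ) ≡ φ θ * φ x
    second = trans (φ-* x θ) (*-comm (φ x) (φ θ))

  q+1≡1+|𝔽q| : q ℕ.+ 1 ≡ suc (length 𝔽q-elements)
  q+1≡1+|𝔽q| = trans (ℕₚ.+-comm q 1) (cong suc (sym |𝔽q|≡q))

  module _ {u : Carrier} (u≢0 : u ≢ 0#) where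

    private
      dir : Fin (q ℕ.+ 1) → Fin (suc (length 𝔽q-elements))
      dir = Fin.cast q+1≡1+|𝔽q|

    line-parameter : Fin (q ℕ.+ 1) → Carrier
    line-parameter i = u≢0 ⁻¹ * direction (dir i)

    line-parameter-≢0 : ∀ i → line-parameter i ≢ 0#
    line-parameter-≢0 i = *-≢0 (⁻¹-≢0 u≢0) (direction-≢0 (dir i))

    line∋π-line-parameter : ∀ i → Incident (line u) (π (line-parameter i))
    line∋π-line-parameter i = begin
      dot (line u) (π (line-parameter i))    ≡⟨ dot-line-π u (line-parameter i) ⟩
      N * Tr (u * line-parameter i)          ≡⟨ cong (λ x → N * Tr x) (x*[x⁻¹*y]≡y u≢0 _) ⟩
      N * Tr (direction (dir i))             ≡⟨ cong (N *_) (direction-trace-zero (dir i)) ⟩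
      N * 0#                                 ≡⟨ zeroʳ N ⟩
      0#                                     ∎

    π-line-parameter-injective : ∀ i j → π (line-parameter i) ∼ π (line-parameter j) → i ≡ j
    π-line-parameter-injective i j (l , _ , πrᵢ≡lπrⱼ) =
      let rᵢ≡lrⱼ , 𝔽q-l = π≡scale⇒𝔽q (line-parameter-≢0 j) πrᵢ≡lπrⱼ
      in cast-injective q+1≡1+|𝔽q| (direction-injective (dir i) (dir j) 𝔽q-l (begin
        direction (dir i)                    ≡⟨ x*[x⁻¹*y]≡y u≢0 _ ⟨
        u * line-parameter i                 ≡⟨ cong (u *_) rᵢ≡lrⱼ ⟩
        u * (l * line-parameter j)           ≡⟨ solve 3 (λ u l r → u :* (l :* r) := l :* (u :* r)) refl u l (line-parameter j) ⟩
        l * (u * line-parameter j)           ≡⟨ cong (l *_) (x*[x⁻¹*y]≡y u≢0 _) ⟩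
        l * direction (dir j)                ∎))

    π∼π-line-parameter : ∀ {r} → r ≢ 0# → Tr (u * r) ≡ 0# → ∃ λ i → π r ∼ π (line-parameter i)
    π∼π-line-parameter {r} r≢0 Tr[ur]≡0 =
      let i′ , c , 𝔽q-c , ur≡cd = direction-complete Tr[ur]≡0
          i : Fin (q ℕ.+ 1)
          i = Fin.cast (sym q+1≡1+|𝔽q|) i′
          r≡cr : r ≡ c * line-parameter i
          r≡cr = begin
            r                                  ≡⟨ x⁻¹*[x*y]≡y u≢0 r ⟨
            u≢0 ⁻¹ * (u * r)                   ≡⟨ cong (u≢0 ⁻¹ *_) ur≡cd ⟩
            u≢0 ⁻¹ * (c * direction i′)        ≡⟨ solve 3 (λ v c d → v :* (c :* d) := c :* (v :* d)) refl (u≢0 ⁻¹) c (direction i′) ⟩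
            c * (u≢0 ⁻¹ * direction i′)
              ≡⟨ cong (λ j → c * (u≢0 ⁻¹ * direction j)) (Finₚ.cast-involutive q+1≡1+|𝔽q| (sym q+1≡1+|𝔽q|) i′) ⟨
            c * line-parameter i               ∎
          c≢0 : c ≢ 0#
          c≢0 c≡0 = r≢0 (trans r≡cr (trans (cong (_* line-parameter i) c≡0) (zeroˡ _)))
      in i , c , c≢0 , trans (cong π r≡cr) (π-𝔽q-* (line-parameter i) 𝔽q-c)

    line-IsLineOf : IsLineOf (Π θ) (line u)
    line-IsLineOf =
      u≢0 ∘ cong proj₁ , π ∘ line-parameter ,
      (λ i → π∈Π (line-parameter-≢0 i) , line∋π-line-parameter i) , π-line-parameter-injective , complete
      where
      complete : ∀ P → Π θ P → Incident (line u) P → ∃ λ i → P ∼ π (line-parameter i)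
      complete P P∈Π P∈line =
        let r , r≢0 , P∼πr = Π⁻ P∈Π
            Tr[ur]≡0 : Tr (u * r) ≡ 0#
            Tr[ur]≡0 = x*y≡0⇒y≡0 N≢0 (trans (sym (dot-line-π u r)) (Incident-∼ P∼πr P∈line))
            i , πr∼ = π∼π-line-parameter r≢0 Tr[ur]≡0
        in i , ∼-trans P∼πr πr∼

  ∧≡0⇒π∼π : ∀ {r₀ r₁} → r₀ ≢ 0# → r₁ ≢ 0# → r₀ ∧ r₁ ≡ 0# → π r₁ ∼ π r₀
  ∧≡0⇒π∼π {r₀} {r₁} r₀≢0 r₁≢0 r₀∧r₁≡0 = c , *-≢0 r₁≢0 (⁻¹-≢0 r₀≢0) , (begin
    π r₁             ≡⟨ cong π (y*x⁻¹*x≡y r₀≢0 r₁) ⟨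
    π (c * r₀)       ≡⟨ π-𝔽q-* r₀ (∧≡0⇒𝔽q-ratio r₀≢0 r₀∧r₁≡0) ⟩
    scale c (π r₀)   ∎)
    where
    c : Carrier
    c = r₁ * r₀≢0 ⁻¹
  line-through-π : ∀ {ℓ r₀ r₁} → NonZero3 ℓ → Incident ℓ (π r₀) → Incident ℓ (π r₁) → r₀ ∧ r₁ ≢ 0# →
                   ℓ ∼ line (φ (r₀ ∧ r₁))
  line-through-π {r₀ = r₀} {r₁} ℓ≢0 ℓ∋πr₀ ℓ∋πr₁ w≢0 =
    ∼-trans (line-through ℓ≢0 ℓ∋πr₀ ℓ∋πr₁ π×π≢0)
            (subst (_∼ line (φ (r₀ ∧ r₁))) (sym (cross-π r₀ r₁)) (scale-∼ (line (φ (r₀ ∧ r₁))) θ≢0))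
    where
    π×π≢0 : NonZero3 (cross (π r₀) (π r₁))
    π×π≢0 π×π≡0 = *-≢0 θ≢0 (φ-≢0 w≢0) (cong proj₁ (trans (sym (cross-π r₀ r₁)) π×π≡0))

  IsLineOf⇒∼line : ∀ {ℓ} → IsLineOf (Π θ) ℓ → ∃ λ u → u ≢ 0# × ℓ ∼ line u
  IsLineOf⇒∼line {ℓ} (ℓ≢0 , pts , pts∈Π∩ℓ , distinct , _) =
    let r₀ , r₀≢0 , p₀∼πr₀ = Π⁻ (proj₁ (pts∈Π∩ℓ i₀))
        r₁ , r₁≢0 , p₁∼πr₁ = Π⁻ (proj₁ (pts∈Π∩ℓ i₁))
        w≢0 : r₀ ∧ r₁ ≢ 0#
        w≢0 w≡0 = i₀≢i₁ (distinct i₀ i₁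
                    (∼-trans p₀∼πr₀ (∼-trans (∼-sym (∧≡0⇒π∼π r₀≢0 r₁≢0 w≡0)) (∼-sym p₁∼πr₁))))
    in φ (r₀ ∧ r₁) , φ-≢0 w≢0 ,
       line-through-π ℓ≢0 (Incident-∼ p₀∼πr₀ (proj₂ (pts∈Π∩ℓ i₀))) (Incident-∼ p₁∼πr₁ (proj₂ (pts∈Π∩ℓ i₁))) w≢0
    where
    1<q+1 : 1 ℕ.< q ℕ.+ 1
    1<q+1 = ℕₚ.<-≤-trans 2≤q (ℕₚ.m≤m+n q 1)
    i₀ i₁ : Fin (q ℕ.+ 1)
    i₀ = Fin.fromℕ< (ℕₚ.<-trans ℕ.z<s 1<q+1)
    i₁ = Fin.fromℕ< 1<q+1
    i₀≢i₁ : i₀ ≢ i₁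
    i₀≢i₁ i₀≡i₁ = ℕₚ.0≢1+n (trans (sym (Finₚ.toℕ-fromℕ< _)) (trans (cong toℕ i₀≡i₁) (Finₚ.toℕ-fromℕ< 1<q+1)))

  Pr-Π⊆S : ∀ P → Pr (Π θ) P → S (θ * θ) P
  Pr-Π⊆S P (Q , Q∈Π , P∼TQ∩mT) =
    let r , r≢0 , Q∼πr = Π⁻ Q∈Π
        x : Carrier
        x = r * θ≢0 ⁻¹
    in S⁺ (*-≢0 r≢0 (⁻¹-≢0 θ≢0)) (∼-trans P∼TQ∩mT (∼-trans (cross-∼ˡ mT (cross-∼ʳ T Q∼πr))
         (subst (λ s → meet (join T (π s)) mT ∼ (x * (θ * θ) , φ x , 0#)) (y*x⁻¹*x≡y θ≢0 r) (projection-π x))))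

  S⊆Pr-Π : ∀ P → S (θ * θ) P → Pr (Π θ) P
  S⊆Pr-Π P P∈S =
    let x , x≢0 , P∼ = S⁻ P∈S
    in π (x * θ) , π∈Π (*-≢0 x≢0 θ≢0) , ∼-trans P∼ (∼-sym (projection-π x))

  Sp-Π⊆S : ∀ P → Sp (Π θ) P → S (- (θ * θ)) P
  Sp-Π⊆S P (ℓ , ℓ-line , P∼ℓ∩mT) =
    let u , u≢0 , ℓ∼line-u = IsLineOf⇒∼line ℓ-line
        θu≢0 : θ * u ≢ 0#
        θu≢0 = *-≢0 θ≢0 u≢0
        θxu≡1 : θ * θu≢0 ⁻¹ * u ≡ 1#
        θxu≡1 = trans (solve 3 (λ t x u → t :* x :* u := t :* u :* x) refl θ (θu≢0 ⁻¹) u) (x*x⁻¹≡1 θu≢0)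
    in S⁺ (⁻¹-≢0 θu≢0) (∼-trans P∼ℓ∩mT (∼-trans (cross-∼ˡ mT ℓ∼line-u) (∼-sym (meet-line θxu≡1))))

  S⊆Sp-Π : ∀ P → S (- (θ * θ)) P → Sp (Π θ) P
  S⊆Sp-Π P P∈S =
    let x , x≢0 , P∼ = S⁻ P∈S
        θx≢0 : θ * x ≢ 0#
        θx≢0 = *-≢0 θ≢0 x≢0
    in line (θx≢0 ⁻¹) , line-IsLineOf (⁻¹-≢0 θx≢0) , ∼-trans P∼ (meet-line (x*x⁻¹≡1 θx≢0))

open import Data.Nat using (_^_)

theorem5p1 : (p k : ℕ) → Prime p → (F : FiniteField) →
    length (FiniteField.elems F) ≡ (p ^ suc k) ^ 3 →
    (θ : FiniteField.Carrier F) → θ ≢ FiniteField.0# F →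
    let open FiniteField F in
    let open PG F (p ^ suc k) in
    SameSet (Pr (Π θ)) (S (θ * θ)) × SameSet (Sp (Π θ)) (S (- (θ * θ)))
theorem5p1 p k p-prime F |F|≡q³ θ θ≢0 =
  (λ P _ → Pr-Π⊆S P , S⊆Pr-Π P) , (λ P _ → Sp-Π⊆S P , S⊆Sp-Π P)
  where open Subplane F p k p-prime |F|≡q³ θ θ≢0
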